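{- Let $\alpha>1$ be irrational with continued fraction $\alpha=[a_0,a_1,\ldots]$ and convergent numerators $p_n$. Let $n\ge0$ and let $k$ be an integer with $1\le k\le a_{n+2}-1$, so that $x=p_n+k\,p_{n+1}$ is the numerator of an intermediate fraction. Then $x\in S_\alpha$ if and only if at least one of the following holds: (i) $p_{n+1}$ is even; (ii) $k=1$ and $p_n$ is odd; (iii) $k=a_{n+2}-1$ and $p_{n+2}$ is odd.
   Context: Continued fraction numerators: $p_{ -2}=0$, $p_{ -1}=1$, $p_{n+1}=a_{n+1}p_n+p_{n-1}$ for $n\ge-1$ (similarly $q_n$ with $q_{ -2}=1,q_{ -1}=0$); intermediate fractions are $(p_n+kp_{n+1})/(q_n+kq_{n+1})$ with $1\le k\le a_{n+2}-1$. For a positive integer $m$, $E(m)=m-q\alpha$ where $q\alpha$ is the integer multiple of $\alpha$ nearest to $m$. $A_\alpha=\{m\in\mathbb N:E(m)<0\}$, $B_\alpha=\{m\in\mathbb N:E(m)>0\}$, and $S_\alpha$ is the set of positive integers not expressible as $y_1+y_2$ with $y_1\ne y_2$ lying both in $A_\alpha$ or both in $B_\alpha$. -}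

module Defs where

open import Data.Nat using (ℕ; zero; suc; _+_; _*_; _∸_; _≤_; _<_)
open import Data.Nat.Divisibility using (_∣_)
open import Data.Product using (Σ; _×_; ∃)
open import Data.Sum using (_⊎_)
open import Relation.Nullary using (¬_)
open import Relation.Binary.PropositionalEquality using (_≡_; _≢_)

-- A continued fraction [a 0, a 1, a 2, ...] is represented by a : ℕ → ℕ.
-- An irrational α > 1 corresponds exactly to an infinite sequence with
-- a 0 ≥ 1 and a i ≥ 1 for i ≥ 1.
ValidCF : (ℕ → ℕ) → Set
ValidCF a = (1 ≤ a 0) × (∀ i → 1 ≤ a (suc i))

-- Shifted numerators/denominators: P a i = p_{i-2}, Q a i = q_{i-2}.
P : (ℕ → ℕ) → ℕ → ℕ
P a zero = 0
P a (suc zero) = 1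
P a (suc (suc i)) = a i * P a (suc i) + P a i

Q : (ℕ → ℕ) → ℕ → ℕ
Q a zero = 1
Q a (suc zero) = 0
Q a (suc (suc i)) = a i * Q a (suc i) + Q a i

p : (ℕ → ℕ) → ℕ → ℕ
p a n = P a (suc (suc n))

q : (ℕ → ℕ) → ℕ → ℕ
q a n = Q a (suc (suc n))

-- The real α = [a 0; a 1, ...] is given by its Dedekind cut:
-- u / v < α  iff some even convergent exceeds u / v   (v ≥ 1 intended)
Below : (ℕ → ℕ) → ℕ → ℕ → Set
Below a u v = ∃ λ n → u * q a (2 * n) < p a (2 * n) * v

-- v · α < u  iff some odd convergent is below u / v
Above : (ℕ → ℕ) → ℕ → ℕ → Set
Above a u v = ∃ λ n → p a (suc (2 * n)) * v < u * q a (suc (2 * n))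

-- E(m) < 0 : the nearest multiple cα of α to m satisfies cα > m, i.e.
-- there is c ≥ 1 with  m < cα  and  (2c-1)α < 2m  (so cα is nearer than (c-1)α).
InA : (ℕ → ℕ) → ℕ → Set
InA a m = (1 ≤ m) × ∃ λ c → (1 ≤ c) × Below a m c × Above a (2 * m) (2 * c ∸ 1)

-- E(m) > 0 : there is c ≥ 0 with  cα < m  and  2m < (2c+1)α.
InB : (ℕ → ℕ) → ℕ → Set
InB a m = (1 ≤ m) × ∃ λ c → Above a m c × Below a (2 * m) (suc (2 * c))

InS : (ℕ → ℕ) → ℕ → Set
InS a x = (1 ≤ x) × ¬ (Σ ℕ λ y₁ → Σ ℕ λ y₂ →
  (y₁ ≢ y₂) × (y₁ + y₂ ≡ x) × ((InA a y₁ × InA a y₂) ⊎ (InB a y₁ × InB a y₂)))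

Even : ℕ → Set
Even n = 2 ∣ n

Odd : ℕ → Set
Odd n = ¬ (2 ∣ n)

module Submission where

-- Write v_j = (p_j, q_j) for the convergent vectors of α and measure a lattice point (h, M)
-- by M α − h, computed at finite precision as M p_N − h q_N for a large index N. Then
-- E(y) < 0 (resp. E(y) > 0) says that 2cα − 2y (resp. 2y − 2cα) lies in (0, α) for some c.
-- If distinct y₁, y₂ of the same class have y₁ + y₂ = x = p_n + k p_{n+1}, adding their two
-- windows puts the coordinates (s, r) of (2y₁, M₁) in the basis v_n, v_{n+1} strictly inside
-- the parallelogram spanned by 0 and 2(1, k). This forces s = 1, i.e. 2y₁ = p_n + ρ p_{n+1}
-- with ρ ≠ k and max(0, 2k − a_{n+2}) ≤ ρ ≤ min(2k, a_{n+2}), and each of (i)–(iii) makes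
-- all these numbers odd, as p_n and p_{n+1} are never both even. Conversely the halves of
-- the numbers p_n + ρ p_{n+1} with ρ ≤ a_{n+2} all lie in one class, fixed by the parity of
-- n, so when (i)–(iii) fail, ρ = k ∓ 1 or ρ = k ∓ 2 yields a forbidden pair.

open import Defs
open import Data.Nat using (ℕ; zero; suc; _+_; _*_; _∸_; _≤_; _<_; z≤n; s≤s; _⊔_; parity)
import Data.Nat.Properties as ℕ
open import Data.Nat.Divisibility using (divides)
open import Data.Integer as ℤ using (ℤ; +_; 0ℤ; 1ℤ; -1ℤ)
  renaming (_+_ to _+ᶻ_; _-_ to _-ᶻ_; _*_ to _*ᶻ_; -_ to -ᶻ_)
import Data.Integer.Properties as ℤ
open import Data.Integer.Tactic.RingSolver using (solve-∀; solve)
open import Data.List using ([]; _∷_)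
open import Data.Parity.Base using (0ℙ; 1ℙ) renaming (_+_ to _+ᵖ_; _*_ to _*ᵖ_)
import Data.Parity.Properties as ℙ
open import Data.Nat.Tactic.RingSolver using () renaming (solve-∀ to solveℕ-∀)
open import Relation.Binary.Definitions using (tri<; tri≈; tri>)
open import Data.Product using (Σ; ∃; ∃₂; _×_; _,_; proj₁; proj₂)
open import Data.Sum using (_⊎_; inj₁; inj₂)
open import Data.Empty using (⊥; ⊥-elim)
open import Relation.Nullary using (¬_; yes; no)
open import Relation.Binary.PropositionalEquality
  using (_≡_; _≢_; refl; sym; trans; cong; cong₂; subst; subst₂; module ≡-Reasoning)
open import Function.Bundles using (_⇔_; mk⇔)

-- A sign of an integer is certified by a natural-number witness; an inequality is proved by
-- writing the quantity, through a ring identity, as a combination of certified terms.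
infix 4 _≥0 _>0

_≥0 : ℤ → Set
x ≥0 = ∃ λ n → x ≡ + n

_>0 : ℤ → Set
x >0 = ∃ λ n → x ≡ + suc n

≥0-≡ : ∀ {x y} → x ≥0 → x ≡ y → y ≥0
≥0-≡ x≥0 refl = x≥0

>0-≡ : ∀ {x y} → x >0 → x ≡ y → y >0
>0-≡ x>0 refl = x>0

+-≥0 : ∀ n → + n ≥0
+-≥0 n = n , refl

+-suc->0 : ∀ n → + suc n >0
+-suc->0 n = n , refl

>0⇒≥0 : ∀ {x} → x >0 → x ≥0
>0⇒≥0 (n , refl) = suc n , refl

≥0-+ : ∀ {x y} → x ≥0 → y ≥0 → x +ᶻ y ≥0
≥0-+ (m , refl) (n , refl) = m + n , refl

>0-+ : ∀ {x y} → x >0 → y ≥0 → x +ᶻ y >0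
>0-+ (m , refl) (n , refl) = m + n , refl

≥0-* : ∀ {x y} → x ≥0 → y ≥0 → x *ᶻ y ≥0
≥0-* (m , refl) (n , refl) = m * n , sym (ℤ.pos-* m n)

>0-* : ∀ {x y} → x >0 → y >0 → x *ᶻ y >0
>0-* (m , refl) (n , refl) = n + m * suc n , refl

>0-pred : ∀ {x} → x >0 → x -ᶻ 1ℤ ≥0
>0-pred {x} (n , refl) = n , ℤ.+-comm x -1ℤ

≥0-or-<0 : ∀ x → x ≥0 ⊎ -ᶻ x >0
≥0-or-<0 (+ n) = inj₁ (n , refl)
≥0-or-<0 ℤ.-[1+ n ] = inj₂ (n , refl)

>0⇒¬-≥0 : ∀ {x} → x >0 → -ᶻ x ≥0 → ⊥
>0⇒¬-≥0 (n , refl) (m , ())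

≥0-antisym : ∀ {x} → x ≥0 → -ᶻ x ≥0 → x ≡ 0ℤ
≥0-antisym (zero , refl) _ = refl
≥0-antisym (suc n , refl) (m , ())

≥0-by-contradiction : ∀ x → (-ᶻ x -ᶻ 1ℤ ≥0 → ⊥) → x ≥0
≥0-by-contradiction x x≰-1 with ≥0-or-<0 x
... | inj₁ x≥0 = x≥0
... | inj₂ -x>0 = ⊥-elim (x≰-1 (>0-pred -x>0))

>0-cancelˡ-* : ∀ {x y} → x >0 → x *ᶻ y >0 → y >0
>0-cancelˡ-* {x} {y} x>0 xy>0 with ≥0-or-<0 y
... | inj₂ -y>0 = ⊥-elim (>0⇒¬-≥0 xy>0 (≥0-≡ (>0⇒≥0 (>0-* x>0 -y>0)) (sym (ℤ.neg-distribʳ-* x y))))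
... | inj₁ (suc n , refl) = n , refl
... | inj₁ (zero , refl) with trans (sym (proj₂ xy>0)) (ℤ.*-zeroʳ x)
...   | ()

0≤⇒≥0 : ∀ {x} → 0ℤ ℤ.≤ x → x ≥0
0≤⇒≥0 {+ n} _ = n , refl

≤⇒≥0 : ∀ {m n} → m ≤ n → + n -ᶻ + m ≥0
≤⇒≥0 m≤n = 0≤⇒≥0 (ℤ.i≤j⇒0≤j-i (ℤ.+≤+ m≤n))

≥0⇒≤ : ∀ {m n} → + n -ᶻ + m ≥0 → m ≤ n
≥0⇒≤ (t , eq) = ℤ.drop‿+≤+ (ℤ.0≤i-j⇒j≤i (subst (0ℤ ℤ.≤_) (sym eq) (ℤ.+≤+ z≤n)))

<⇒>0 : ∀ {m n} → m < n → + n -ᶻ + m >0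
<⇒>0 {m} {n} m<n with ≤⇒≥0 m<n
... | t , eq = t , trans (shift (+ n) (+ m)) (trans (cong (_+ᶻ 1ℤ) eq) (ℤ.+-comm (+ t) 1ℤ))
  where
  shift : ∀ n m → n -ᶻ m ≡ (n -ᶻ (1ℤ +ᶻ m)) +ᶻ 1ℤ
  shift = solve-∀

>0⇒< : ∀ {m n} → + n -ᶻ + m >0 → m < n
>0⇒< {m} {n} (t , eq) = ≥0⇒≤ (t , trans (shift (+ n) (+ m)) (cong (_-ᶻ 1ℤ) eq))
  where
  shift : ∀ n m → n -ᶻ (1ℤ +ᶻ m) ≡ (n -ᶻ m) -ᶻ 1ℤ
  shift = solve-∀

Unit : ℤ → Set
Unit σ = σ ≡ 1ℤ ⊎ σ ≡ -1ℤ

unit-square : ∀ {σ} → Unit σ → σ *ᶻ σ ≡ 1ℤ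
unit-square (inj₁ refl) = refl
unit-square (inj₂ refl) = refl

units-equal-or-opposite : ∀ {σ τ} → Unit σ → Unit τ → σ ≡ τ ⊎ σ ≡ -ᶻ τ
units-equal-or-opposite (inj₁ refl) (inj₁ refl) = inj₁ refl
units-equal-or-opposite (inj₁ refl) (inj₂ refl) = inj₂ refl
units-equal-or-opposite (inj₂ refl) (inj₁ refl) = inj₂ refl
units-equal-or-opposite (inj₂ refl) (inj₂ refl) = inj₁ refl

2*≢unit : ∀ {σ} z → Unit σ → + 2 *ᶻ z ≢ σ
2*≢unit z u eq = ℕ.even≢odd ℤ.∣ z ∣ 0 (trans (sym (ℤ.abs-* (+ 2) z)) (trans (cong ℤ.∣_∣ eq) (abs≡1 u)))
  where
  abs≡1 : ∀ {σ} → Unit σ → ℤ.∣ σ ∣ ≡ 1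
  abs≡1 (inj₁ refl) = refl
  abs≡1 (inj₂ refl) = refl

1≤⇒>0 : ∀ {n} → 1 ≤ n → + n >0
1≤⇒>0 {suc n} _ = n , refl

2*-pos : ∀ {y} → 1 ≤ y → + (2 * y) >0
2*-pos {y} 1≤y = 1≤⇒>0 (ℕ.≤-trans 1≤y (ℕ.m≤m+n y (y + 0)))

-- Parity

parity-2* : ∀ m → parity (2 * m) ≡ 0ℙ
parity-2* m = ℙ.*-homo-* 2 m

even⇒parity≡0ℙ : ∀ {n} → Even n → parity n ≡ 0ℙ
even⇒parity≡0ℙ (divides q refl) = trans (ℙ.*-homo-* q 2) (ℙ.*-zeroʳ (parity q))

parity≡0ℙ⇒even : ∀ n → parity n ≡ 0ℙ → Even n
parity≡0ℙ⇒even zero _ = divides 0 refl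
parity≡0ℙ⇒even (suc (suc n)) eq with parity≡0ℙ⇒even n eq
... | divides q refl = divides (suc q) refl

parity≡1ℙ⇒odd : ∀ {n} → parity n ≡ 1ℙ → Odd n
parity≡1ℙ⇒odd eq ev with trans (sym eq) (even⇒parity≡0ℙ ev)
... | ()

odd⇒parity≡1ℙ : ∀ n → Odd n → parity n ≡ 1ℙ
odd⇒parity≡1ℙ n odd with parity n in eq
... | 0ℙ = ⊥-elim (odd (parity≡0ℙ⇒even n eq))
... | 1ℙ = refl

parity-+* : ∀ p₀ ρ p₁ → parity (p₀ + ρ * p₁) ≡ parity p₀ +ᵖ (parity ρ *ᵖ parity p₁)
parity-+* p₀ ρ p₁ = trans (ℙ.+-homo-+ p₀ (ρ * p₁)) (cong (parity p₀ +ᵖ_) (ℙ.*-homo-* ρ p₁))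

parity-shift : ∀ p₀ p₁ d r → parity p₁ ≡ 1ℙ →
  parity (p₀ + (d + r) * p₁) ≡ parity d +ᵖ parity (p₀ + r * p₁)
parity-shift p₀ p₁ d r p₁-odd = begin
  parity (p₀ + (d + r) * p₁)       ≡⟨ cong parity (regroup p₀ d r p₁) ⟩
  parity (d * p₁ + (p₀ + r * p₁))  ≡⟨ ℙ.+-homo-+ (d * p₁) (p₀ + r * p₁) ⟩
  parity (d * p₁) +ᵖ π             ≡⟨ cong (_+ᵖ π) (ℙ.*-homo-* d p₁) ⟩
  parity d *ᵖ parity p₁ +ᵖ π       ≡⟨ cong (λ q → parity d *ᵖ q +ᵖ π) p₁-odd ⟩
  parity d *ᵖ 1ℙ +ᵖ π              ≡⟨ cong (_+ᵖ π) (ℙ.*-identityʳ (parity d)) ⟩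
  parity d +ᵖ π                    ∎
  where
  open ≡-Reasoning
  π = parity (p₀ + r * p₁)
  regroup : ∀ p₀ d r p₁ → p₀ + (d + r) * p₁ ≡ d * p₁ + (p₀ + r * p₁)
  regroup = solveℕ-∀

even-or-odd : ∀ n → ∃ λ t → n ≡ 2 * t ⊎ n ≡ 1 + 2 * t
even-or-odd zero = 0 , inj₁ refl
even-or-odd (suc n) with even-or-odd n
... | t , inj₁ refl = t , inj₂ refl
... | t , inj₂ refl = suc t , inj₁ (cong suc (sym (ℕ.+-suc t (t + 0))))

Criterion : (p₀ p₁ a k : ℕ) → Set
Criterion p₀ p₁ a k = Even p₁ ⊎ ((k ≡ 1) × Odd p₀) ⊎ ((k + 1 ≡ a) × Odd (a * p₁ + p₀))

-- The constraints on ρ are those produced by Parallelogram.between⇒half-point.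
criterion⇒odd : ∀ {p₀ p₁ a k ρ} → Criterion p₀ p₁ a k → (Even p₀ → Even p₁ → ⊥) →
  ρ ≤ 2 * k → ρ ≤ a → 2 * k ≤ ρ + a → ρ ≢ k → parity (p₀ + ρ * p₁) ≡ 1ℙ
criterion⇒odd {p₀} {p₁} {a} {k} {ρ} (inj₁ p₁-even) not-both-even _ _ _ _ = begin
  parity (p₀ + ρ * p₁)                  ≡⟨ parity-+* p₀ ρ p₁ ⟩
  parity p₀ +ᵖ (parity ρ *ᵖ parity p₁)  ≡⟨ cong (λ x → parity p₀ +ᵖ (parity ρ *ᵖ x)) (even⇒parity≡0ℙ p₁-even) ⟩
  parity p₀ +ᵖ (parity ρ *ᵖ 0ℙ)         ≡⟨ cong (parity p₀ +ᵖ_) (ℙ.*-zeroʳ (parity ρ)) ⟩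
  parity p₀ +ᵖ 0ℙ                       ≡⟨ ℙ.+-identityʳ (parity p₀) ⟩
  parity p₀                             ≡⟨ odd⇒parity≡1ℙ p₀ (λ p₀-even → not-both-even p₀-even p₁-even) ⟩
  1ℙ                                    ∎
  where open ≡-Reasoning
criterion⇒odd {p₀} {p₁} {ρ = ρ} (inj₂ (inj₁ (refl , p₀-odd))) _ ρ≤2 _ _ ρ≢1 =
  trans (parity-+* p₀ ρ p₁)
        (cong₂ (λ x y → x +ᵖ (y *ᵖ parity p₁)) (odd⇒parity≡1ℙ p₀ p₀-odd) (ρ-even ρ ρ≤2 ρ≢1))
  where
  ρ-even : ∀ ρ → ρ ≤ 2 → ρ ≢ 1 → parity ρ ≡ 0ℙ
  ρ-even 0 _ _ = refl
  ρ-even 1 _ ρ≢1 = ⊥-elim (ρ≢1 refl)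
  ρ-even 2 _ _ = refl
  ρ-even (suc (suc (suc _))) (s≤s (s≤s ())) _
criterion⇒odd {p₀} {p₁} {k = k} {ρ} (inj₂ (inj₂ (refl , p₂-odd))) _ _ ρ≤a 2k≤ρ+a ρ≢k = begin
  parity (p₀ + ρ * p₁)                  ≡⟨ parity-+* p₀ ρ p₁ ⟩
  parity p₀ +ᵖ (parity ρ *ᵖ parity p₁)  ≡⟨ cong (λ x → parity p₀ +ᵖ (x *ᵖ parity p₁)) ρ≡a-mod-2 ⟩
  parity p₀ +ᵖ (parity a *ᵖ parity p₁)  ≡⟨ ℙ.+-comm (parity p₀) _ ⟩
  (parity a *ᵖ parity p₁) +ᵖ parity p₀  ≡⟨ cong (_+ᵖ parity p₀) (ℙ.*-homo-* a p₁) ⟨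
  parity (a * p₁) +ᵖ parity p₀          ≡⟨ ℙ.+-homo-+ (a * p₁) p₀ ⟨
  parity (a * p₁ + p₀)                  ≡⟨ odd⇒parity≡1ℙ _ p₂-odd ⟩
  1ℙ                                    ∎
  where
  open ≡-Reasoning
  a = k + 1
  k≤ρ+1 : k ≤ ρ + 1
  k≤ρ+1 = ℕ.+-cancelˡ-≤ k k (ρ + 1) (subst₂ _≤_ (lem₁ k) (lem₂ ρ k) 2k≤ρ+a)
    where
    lem₁ : ∀ k → 2 * k ≡ k + k
    lem₁ = solveℕ-∀
    lem₂ : ∀ ρ k → ρ + (k + 1) ≡ k + (ρ + 1)
    lem₂ = solveℕ-∀
  ρ≡a-mod-2 : parity ρ ≡ parity a
  ρ≡a-mod-2 with ℕ.<-cmp ρ k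
  ... | tri≈ _ ρ≡k _ = ⊥-elim (ρ≢k ρ≡k)
  ... | tri> _ _ k<ρ = cong parity (ℕ.≤-antisym ρ≤a (subst (_≤ ρ) (ℕ.+-comm 1 k) k<ρ))
  ... | tri< ρ<k _ _ = cong parity (sym a≡ρ+2)
    where
    a≡ρ+2 : a ≡ suc (suc ρ)
    a≡ρ+2 = trans (ℕ.+-comm k 1) (cong suc (ℕ.≤-antisym (subst (k ≤_) (ℕ.+-comm ρ 1) k≤ρ+1) ρ<k))

InWindow : ℤ → ℤ → Set
InWindow P ℓ = ℓ >0 × P -ᶻ ℓ >0

-- The offset τ cannot be positive, since ℓ₁ + ℓ₂ < 2P.
pair-bound : ∀ {P ℓ₁ ℓ₂ ℓ τ} → InWindow P ℓ₁ → InWindow P ℓ₂ → ℓ ≥0 →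
  ℓ₁ +ᶻ ℓ₂ ≡ + 2 *ᶻ ℓ +ᶻ + 2 *ᶻ (τ *ᶻ P) → + 2 *ᶻ ℓ -ᶻ ℓ₁ >0
pair-bound {P} {ℓ₁} {ℓ₂} {ℓ} {τ} (ℓ₁>0 , ℓ₁<P) (ℓ₂>0 , ℓ₂<P) ℓ≥0 sum =
  >0-≡ (>0-+ ℓ₂>0 (≥0-* (+-≥0 2) (≥0-* τ≤0 (>0⇒≥0 P>0)))) (sym difference)
  where
  open ≡-Reasoning
  P>0 : P >0
  P>0 = >0-≡ (>0-+ ℓ₁<P (>0⇒≥0 ℓ₁>0)) (lem P ℓ₁)
    where
    lem : ∀ P ℓ → (P -ᶻ ℓ) +ᶻ ℓ ≡ P
    lem = solve-∀
  gaps : -ᶻ ((P -ᶻ ℓ₁) +ᶻ (P -ᶻ ℓ₂)) ≡ + 2 *ᶻ ℓ +ᶻ + 2 *ᶻ ((-ᶻ (-ᶻ τ) -ᶻ 1ℤ) *ᶻ P)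
  gaps = begin
    -ᶻ ((P -ᶻ ℓ₁) +ᶻ (P -ᶻ ℓ₂))                   ≡⟨ solve (P ∷ ℓ₁ ∷ ℓ₂ ∷ []) ⟩
    (ℓ₁ +ᶻ ℓ₂) -ᶻ + 2 *ᶻ P                        ≡⟨ cong (_-ᶻ + 2 *ᶻ P) sum ⟩
    + 2 *ᶻ ℓ +ᶻ + 2 *ᶻ (τ *ᶻ P) -ᶻ + 2 *ᶻ P       ≡⟨ solve (ℓ ∷ τ ∷ P ∷ []) ⟩
    + 2 *ᶻ ℓ +ᶻ + 2 *ᶻ ((-ᶻ (-ᶻ τ) -ᶻ 1ℤ) *ᶻ P)  ∎
  τ≤0 : -ᶻ τ ≥0
  τ≤0 = ≥0-by-contradiction (-ᶻ τ) λ τ≥1 → >0⇒¬-≥0 (>0-+ ℓ₁<P (>0⇒≥0 ℓ₂<P))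
    (≥0-≡ (≥0-+ (≥0-* (+-≥0 2) ℓ≥0) (≥0-* (+-≥0 2) (≥0-* τ≥1 (>0⇒≥0 P>0)))) (sym gaps))
  difference : + 2 *ᶻ ℓ -ᶻ ℓ₁ ≡ ℓ₂ +ᶻ + 2 *ᶻ ((-ᶻ τ) *ᶻ P)
  difference = begin
    + 2 *ᶻ ℓ -ᶻ ℓ₁
      ≡⟨ solve (ℓ ∷ ℓ₁ ∷ τ ∷ P ∷ []) ⟩
    (+ 2 *ᶻ ℓ +ᶻ + 2 *ᶻ (τ *ᶻ P)) -ᶻ + 2 *ᶻ (τ *ᶻ P) -ᶻ ℓ₁
      ≡⟨ cong (λ z → z -ᶻ + 2 *ᶻ (τ *ᶻ P) -ᶻ ℓ₁) (sym sum) ⟩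
    (ℓ₁ +ᶻ ℓ₂) -ᶻ + 2 *ᶻ (τ *ᶻ P) -ᶻ ℓ₁
      ≡⟨ solve (ℓ₁ ∷ ℓ₂ ∷ τ ∷ P ∷ []) ⟩
    ℓ₂ +ᶻ + 2 *ᶻ ((-ᶻ τ) *ᶻ P) ∎

-- (s, r) are coordinates in the basis of two consecutive convergent vectors: s p₀ + r p₁ is
-- the numerator of the lattice point and s A − r B its scaled offset from the line of slope α.
module Parallelogram (a p₀ p₁ : ℕ) (p₀<p₁ : p₀ < p₁) (A B C : ℤ)
  (A≡aB+C : A ≡ + a *ᶻ B +ᶻ C) (C≥0 : C ≥0) (C<B : B -ᶻ C >0) where

  Inside : ℤ → ℤ → Set
  Inside s r = s *ᶻ A -ᶻ r *ᶻ B >0 × s *ᶻ + p₀ +ᶻ r *ᶻ + p₁ >0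

  private
    B≥0 : B ≥0
    B≥0 = ≥0-≡ (≥0-+ (>0⇒≥0 C<B) C≥0) (lem B C)
      where
      lem : ∀ B C → (B -ᶻ C) +ᶻ C ≡ B
      lem = solve-∀

    A≥0 : A ≥0
    A≥0 = ≥0-≡ (≥0-+ (≥0-* (+-≥0 a) B≥0) C≥0) (sym A≡aB+C)

  inside⇒1≤s : ∀ {s r} → Inside s r → s -ᶻ 1ℤ ≥0
  inside⇒1≤s {s} {r} (ℓ>0 , h>0) =
    ≥0-by-contradiction (s -ᶻ 1ℤ) (λ s≤0 → outside (≥0-≡ s≤0 (lem s)))
    where
    lem : ∀ s → -ᶻ (s -ᶻ 1ℤ) -ᶻ 1ℤ ≡ -ᶻ s
    lem = solve-∀
    negate⁻ : ∀ s r x y → -ᶻ (s *ᶻ x -ᶻ r *ᶻ y) ≡ (-ᶻ s) *ᶻ x +ᶻ r *ᶻ y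
    negate⁻ = solve-∀
    negate⁺ : ∀ s r x y → -ᶻ (s *ᶻ x +ᶻ r *ᶻ y) ≡ (-ᶻ s) *ᶻ x +ᶻ (-ᶻ r) *ᶻ y
    negate⁺ = solve-∀
    outside : -ᶻ s ≥0 → ⊥
    outside -s≥0 with ≥0-or-<0 r
    ... | inj₁ r≥0 = >0⇒¬-≥0 ℓ>0
      (≥0-≡ (≥0-+ (≥0-* -s≥0 A≥0) (≥0-* r≥0 B≥0)) (sym (negate⁻ s r A B)))
    ... | inj₂ -r>0 = >0⇒¬-≥0 h>0
      (≥0-≡ (≥0-+ (≥0-* -s≥0 (+-≥0 p₀)) (≥0-* (>0⇒≥0 -r>0) (+-≥0 p₁))) (sym (negate⁺ s r (+ p₀) (+ p₁))))

  inside⇒r≤a : ∀ {r} → Inside 1ℤ r → + a -ᶻ r ≥0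
  inside⇒r≤a {r} (ℓ>0 , _) = ≥0-by-contradiction (+ a -ᶻ r) λ r>a →
    >0⇒¬-≥0 ℓ>0 (≥0-≡ (≥0-+ (>0⇒≥0 C<B) (≥0-* r>a B≥0)) (sym (lem A (+ a) r B C A≡aB+C)))
    where
    lem : ∀ A a r B C → A ≡ a *ᶻ B +ᶻ C → -ᶻ (1ℤ *ᶻ A -ᶻ r *ᶻ B) ≡ (B -ᶻ C) +ᶻ (-ᶻ (a -ᶻ r) -ᶻ 1ℤ) *ᶻ B
    lem A a r B C refl = solve (a ∷ r ∷ B ∷ C ∷ [])

  inside⇒0≤r : ∀ {r} → Inside 1ℤ r → r ≥0
  inside⇒0≤r {r} (_ , h>0) = ≥0-by-contradiction r λ r<0 →
    >0⇒¬-≥0 h>0 (≥0-≡ (≥0-+ (>0⇒≥0 (<⇒>0 p₀<p₁)) (≥0-* r<0 (+-≥0 p₁))) (sym (lem r (+ p₀) (+ p₁))))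
    where
    lem : ∀ r p₀ p₁ → -ᶻ (1ℤ *ᶻ p₀ +ᶻ r *ᶻ p₁) ≡ (p₁ -ᶻ p₀) +ᶻ (-ᶻ r -ᶻ 1ℤ) *ᶻ p₁
    lem = solve-∀

  -- The parallelogram is symmetric under (s, r) ↦ (2 - s, 2k - r), which swaps the two
  -- bounds on each coordinate.
  private
    inside-twice : ∀ {s r} k → Inside s r → Inside (+ 2 -ᶻ s) (+ (2 * k) -ᶻ r) →
      s ≡ 1ℤ × ∃ λ ρ → r ≡ + ρ × ρ ≤ 2 * k × ρ ≤ a × 2 * k ≤ ρ + a
    inside-twice {s} {r} k in₁ in₂ with s≡1
      where
      s≡1 : s ≡ 1ℤ
      s≡1 = trans (lem₁ s) (cong (_+ᶻ 1ℤ) (≥0-antisym (inside⇒1≤s {s} {r} in₁)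
              (≥0-≡ (inside⇒1≤s {+ 2 -ᶻ s} {+ (2 * k) -ᶻ r} in₂) (lem₂ s))))
        where
        lem₁ : ∀ s → s ≡ (s -ᶻ 1ℤ) +ᶻ 1ℤ
        lem₁ = solve-∀
        lem₂ : ∀ s → (+ 2 -ᶻ s) -ᶻ 1ℤ ≡ -ᶻ (s -ᶻ 1ℤ)
        lem₂ = solve-∀
    ... | refl with inside⇒0≤r {r} in₁
    ... | ρ , refl = refl , ρ , refl , ≥0⇒≤ (inside⇒0≤r {r′} in₂) , ≥0⇒≤ (inside⇒r≤a {+ ρ} in₁) ,
                     ≥0⇒≤ (≥0-≡ (inside⇒r≤a {r′} in₂) (lem (+ a) (+ (2 * k)) (+ ρ)))
      where
      r′ = + (2 * k) -ᶻ + ρ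
      lem : ∀ a t ρ → a -ᶻ (t -ᶻ ρ) ≡ (ρ +ᶻ a) -ᶻ t
      lem = solve-∀

  -- (s, r) lies strictly between the origin and twice the point (1, k).
  between⇒half-point : ∀ {s r} k → Inside s r →
    + 2 *ᶻ (A -ᶻ + k *ᶻ B) -ᶻ (s *ᶻ A -ᶻ r *ᶻ B) >0 →
    + 2 *ᶻ (+ p₀ +ᶻ + k *ᶻ + p₁) -ᶻ (s *ᶻ + p₀ +ᶻ r *ᶻ + p₁) >0 →
    s ≡ 1ℤ × ∃ λ ρ → r ≡ + ρ × ρ ≤ 2 * k × ρ ≤ a × 2 * k ≤ ρ + a
  between⇒half-point {s} {r} k inside ℓ<2ℓₖ h<2hₖ = inside-twice k inside
    ( >0-≡ ℓ<2ℓₖ (trans (reflect s r (+ k) A B) (cong (λ t → (+ 2 -ᶻ s) *ᶻ A -ᶻ (t -ᶻ r) *ᶻ B) 2k≡))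
    , >0-≡ h<2hₖ (trans (reflect′ s r (+ k) (+ p₀) (+ p₁))
                        (cong (λ t → (+ 2 -ᶻ s) *ᶻ + p₀ +ᶻ (t -ᶻ r) *ᶻ + p₁) 2k≡)))
    where
    reflect : ∀ s r k A B → + 2 *ᶻ (A -ᶻ k *ᶻ B) -ᶻ (s *ᶻ A -ᶻ r *ᶻ B)
      ≡ (+ 2 -ᶻ s) *ᶻ A -ᶻ (+ 2 *ᶻ k -ᶻ r) *ᶻ B
    reflect = solve-∀
    reflect′ : ∀ s r k p₀ p₁ → + 2 *ᶻ (p₀ +ᶻ k *ᶻ p₁) -ᶻ (s *ᶻ p₀ +ᶻ r *ᶻ p₁)
      ≡ (+ 2 -ᶻ s) *ᶻ p₀ +ᶻ (+ 2 *ᶻ k -ᶻ r) *ᶻ p₁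
    reflect′ = solve-∀
    2k≡ : + 2 *ᶻ + k ≡ + (2 * k)
    2k≡ = sym (ℤ.pos-* 2 k)

Eventually : (ℕ → Set) → Set
Eventually Prop = ∃ λ j → ∀ {N} → j ≤ N → Prop N

eventually-× : ∀ {Prop Prop′} → Eventually Prop → Eventually Prop′ → Eventually (λ N → Prop N × Prop′ N)
eventually-× (i , f) (j , g) =
  i ⊔ j , λ le → f (ℕ.≤-trans (ℕ.m≤m⊔n i j) le) , g (ℕ.≤-trans (ℕ.m≤n⊔m i j) le)

eventually-map : ∀ {Prop Prop′} → (∀ N → Prop N → Prop′ N) → Eventually Prop → Eventually Prop′
eventually-map f (j , g) = j , λ {N} le → f N (g le)

eventually-at : ∀ {Prop} j → Eventually Prop → ∃ λ N → j ≤ N × Prop N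
eventually-at j (i , f) = i ⊔ j , ℕ.m≤n⊔m i j , f (ℕ.m≤m⊔n i j)

SameClass : (ℕ → ℕ) → ℕ → ℕ → Set
SameClass a y₁ y₂ = (InA a y₁ × InA a y₂) ⊎ (InB a y₁ × InB a y₂)

SameClassPair : (ℕ → ℕ) → ℕ → Set
SameClassPair a x = Σ ℕ λ y₁ → Σ ℕ λ y₂ → (y₁ ≢ y₂) × (y₁ + y₂ ≡ x) × SameClass a y₁ y₂

same-class⇒positive : ∀ {a y₁ y₂} → SameClass a y₁ y₂ → 1 ≤ y₁ × 1 ≤ y₂
same-class⇒positive (inj₁ (y₁∈A , y₂∈A)) = proj₁ y₁∈A , proj₁ y₂∈A
same-class⇒positive (inj₂ (y₁∈B , y₂∈B)) = proj₁ y₁∈B , proj₁ y₂∈B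

2*-sum : ∀ {y₁ y₂ x} → y₁ + y₂ ≡ x → + (2 * y₁) +ᶻ + (2 * y₂) ≡ + 2 *ᶻ + x
2*-sum {y₁} {y₂} {x} sum =
  trans (cong +_ (trans (sym (ℕ.*-distribˡ-+ 2 y₁ y₂)) (cong (2 *_) sum))) (ℤ.pos-* 2 x)

half-point≢ : ∀ {y₁ y₂ p₀ p₁ ρ k} → 2 * y₁ ≡ p₀ + ρ * p₁ → y₁ + y₂ ≡ p₀ + k * p₁ → y₁ ≢ y₂ → ρ ≢ k
half-point≢ {y₁} {y₂} 2y₁≡ sum y₁≢y₂ refl =
  y₁≢y₂ (ℕ.+-cancelˡ-≡ y₁ y₁ y₂ (trans (trans (cong (λ z → y₁ + z) (sym (ℕ.+-identityʳ y₁))) 2y₁≡) (sym sum)))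

-- Convergents

module ContinuedFraction (a : ℕ → ℕ) (a-pos : ∀ i → 1 ≤ a i) where

  P-pos : ∀ k → 1 ≤ P a (suc k)
  P-pos zero = s≤s z≤n
  P-pos (suc k) = ℕ.≤-trans (ℕ.*-mono-≤ (a-pos k) (P-pos k)) (ℕ.m≤m+n _ _)

  P-increasing : ∀ k → P a (suc (suc k)) < P a (suc (suc (suc k)))
  P-increasing k = ℕ.≤-trans (ℕ.m<m+n (P a (suc (suc k))) (P-pos k)) (ℕ.+-monoˡ-≤ (P a (suc k)) p≤ap)
    where
    p≤ap : P a (suc (suc k)) ≤ a (suc k) * P a (suc (suc k))
    p≤ap = subst (_≤ a (suc k) * P a (suc (suc k))) (ℕ.*-identityˡ _)
                 (ℕ.*-monoˡ-≤ (P a (suc (suc k))) (a-pos (suc k)))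

  Q-pos : ∀ k → 1 ≤ Q a (suc (suc k))
  Q-pos zero = ℕ.m≤n+m 1 (a 0 * 0)
  Q-pos (suc k) = ℕ.≤-trans (ℕ.*-mono-≤ (a-pos (suc k)) (Q-pos k)) (ℕ.m≤m+n _ _)

  Pᶻ Qᶻ aᶻ : ℕ → ℤ
  Pᶻ i = + P a i
  Qᶻ i = + Q a i
  aᶻ i = + a i

  Pᶻ-rec : ∀ i → Pᶻ (suc (suc i)) ≡ aᶻ i *ᶻ Pᶻ (suc i) +ᶻ Pᶻ i
  Pᶻ-rec i = cong (_+ᶻ Pᶻ i) (ℤ.pos-* (a i) (P a (suc i)))

  Qᶻ-rec : ∀ i → Qᶻ (suc (suc i)) ≡ aᶻ i *ᶻ Qᶻ (suc i) +ᶻ Qᶻ i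
  Qᶻ-rec i = cong (_+ᶻ Qᶻ i) (ℤ.pos-* (a i) (Q a (suc i)))

  -- wedge N h M = q_N M (p_N / q_N − h / M): its sign tells on which side of the
  -- convergent the fraction h / M lies.
  wedge : ℕ → ℤ → ℤ → ℤ
  wedge N h M = M *ᶻ Pᶻ N -ᶻ h *ᶻ Qᶻ N

  wedge-rec : ∀ l h M → wedge (suc (suc l)) h M ≡ aᶻ l *ᶻ wedge (suc l) h M +ᶻ wedge l h M
  wedge-rec l h M = begin
    M *ᶻ Pᶻ (suc (suc l)) -ᶻ h *ᶻ Qᶻ (suc (suc l))
      ≡⟨ cong₂ (λ p q → M *ᶻ p -ᶻ h *ᶻ q) (Pᶻ-rec l) (Qᶻ-rec l) ⟩
    M *ᶻ (aᶻ l *ᶻ Pᶻ (suc l) +ᶻ Pᶻ l) -ᶻ h *ᶻ (aᶻ l *ᶻ Qᶻ (suc l) +ᶻ Qᶻ l)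
      ≡⟨ distrib M h (aᶻ l) (Pᶻ (suc l)) (Pᶻ l) (Qᶻ (suc l)) (Qᶻ l) ⟩
    aᶻ l *ᶻ wedge (suc l) h M +ᶻ wedge l h M ∎
    where
    open ≡-Reasoning
    distrib : ∀ M h a p₁ p₀ q₁ q₀ →
      M *ᶻ (a *ᶻ p₁ +ᶻ p₀) -ᶻ h *ᶻ (a *ᶻ q₁ +ᶻ q₀) ≡ a *ᶻ (M *ᶻ p₁ -ᶻ h *ᶻ q₁) +ᶻ (M *ᶻ p₀ -ᶻ h *ᶻ q₀)
    distrib = solve-∀

  wedge-combination : ∀ N j s r → wedge N (s *ᶻ Pᶻ j +ᶻ r *ᶻ Pᶻ (suc j)) (s *ᶻ Qᶻ j +ᶻ r *ᶻ Qᶻ (suc j))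
    ≡ s *ᶻ wedge N (Pᶻ j) (Qᶻ j) +ᶻ r *ᶻ wedge N (Pᶻ (suc j)) (Qᶻ (suc j))
  wedge-combination N j s r = lem s r (Pᶻ j) (Pᶻ (suc j)) (Qᶻ j) (Qᶻ (suc j)) (Pᶻ N) (Qᶻ N)
    where
    lem : ∀ s r p₀ p₁ q₀ q₁ p q → (s *ᶻ q₀ +ᶻ r *ᶻ q₁) *ᶻ p -ᶻ (s *ᶻ p₀ +ᶻ r *ᶻ p₁) *ᶻ q
      ≡ s *ᶻ (q₀ *ᶻ p -ᶻ p₀ *ᶻ q) +ᶻ r *ᶻ (q₁ *ᶻ p -ᶻ p₁ *ᶻ q)
    lem = solve-∀

  wedge-antisym : ∀ j l → wedge l (Pᶻ j) (Qᶻ j) ≡ -ᶻ wedge j (Pᶻ l) (Qᶻ l)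
  wedge-antisym j l = lem (Pᶻ j) (Qᶻ j) (Pᶻ l) (Qᶻ l)
    where
    lem : ∀ pⱼ qⱼ pₗ qₗ → qⱼ *ᶻ pₗ -ᶻ pⱼ *ᶻ qₗ ≡ -ᶻ (qₗ *ᶻ pⱼ -ᶻ pₗ *ᶻ qⱼ)
    lem = solve-∀

  wedge-self : ∀ j → wedge j (Pᶻ j) (Qᶻ j) ≡ 0ℤ
  wedge-self j = lem (Pᶻ j) (Qᶻ j)
    where
    lem : ∀ p q → q *ᶻ p -ᶻ p *ᶻ q ≡ 0ℤ
    lem = solve-∀

  sgn : ℕ → ℤ
  sgn zero = 1ℤ
  sgn (suc j) = -ᶻ sgn j

  sgn-unit : ∀ j → Unit (sgn j)
  sgn-unit zero = inj₁ refl
  sgn-unit (suc j) with sgn-unit j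
  ... | inj₁ eq = inj₂ (cong -ᶻ_ eq)
  ... | inj₂ eq = inj₁ (cong -ᶻ_ eq)

  sgn-2* : ∀ m → sgn (2 * m) ≡ 1ℤ
  sgn-2* zero = refl
  sgn-2* (suc m) = begin
    sgn (2 * suc m)         ≡⟨ cong sgn (cong suc (ℕ.+-suc m (m + 0))) ⟩
    -ᶻ (-ᶻ sgn (2 * m))     ≡⟨ ℤ.neg-involutive _ ⟩
    sgn (2 * m)             ≡⟨ sgn-2* m ⟩
    1ℤ                      ∎
    where open ≡-Reasoning

  wedge-next : ∀ j → wedge (suc j) (Pᶻ j) (Qᶻ j) ≡ sgn j
  wedge-next zero = refl
  wedge-next (suc j) = begin
    wedge (suc (suc j)) (Pᶻ (suc j)) (Qᶻ (suc j))
      ≡⟨ wedge-rec j (Pᶻ (suc j)) (Qᶻ (suc j)) ⟩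
    aᶻ j *ᶻ wedge (suc j) (Pᶻ (suc j)) (Qᶻ (suc j)) +ᶻ wedge j (Pᶻ (suc j)) (Qᶻ (suc j))
      ≡⟨ cong₂ (λ x y → aᶻ j *ᶻ x +ᶻ y) (wedge-self (suc j)) (wedge-antisym (suc j) j) ⟩
    aᶻ j *ᶻ 0ℤ +ᶻ -ᶻ wedge (suc j) (Pᶻ j) (Qᶻ j)
      ≡⟨ cong (λ x → aᶻ j *ᶻ 0ℤ +ᶻ -ᶻ x) (wedge-next j) ⟩
    aᶻ j *ᶻ 0ℤ +ᶻ -ᶻ sgn j
      ≡⟨ cong (_+ᶻ -ᶻ sgn j) (ℤ.*-zeroʳ (aᶻ j)) ⟩
    0ℤ +ᶻ -ᶻ sgn j
      ≡⟨ ℤ.+-identityˡ _ ⟩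
    -ᶻ sgn j ∎
    where open ≡-Reasoning

  sgn-even : ∀ m → sgn (2 + 2 * m) ≡ 1ℤ
  sgn-even m = trans (ℤ.neg-involutive (sgn (2 * m))) (sgn-2* m)

  sgn-odd : ∀ m → sgn (3 + 2 * m) ≡ -1ℤ
  sgn-odd m = cong -ᶻ_ (sgn-even m)

  sgn-even-* : ∀ m x → sgn (2 + 2 * m) *ᶻ x ≡ x
  sgn-even-* m x = trans (cong (_*ᶻ x) (sgn-even m)) (ℤ.*-identityˡ x)

  sgn-odd-* : ∀ m x → sgn (3 + 2 * m) *ᶻ x ≡ -ᶻ x
  sgn-odd-* m x = trans (cong (_*ᶻ x) (sgn-odd m)) (ℤ.-1*i≡-i x)

  -- sgn j · wedge N (p_j, q_j) ≥ 0 says that p_N / q_N lies on the same side of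
  -- p_j / q_j as α does.
  convergent-order : ∀ j m →
    sgn j *ᶻ wedge (m + j) (Pᶻ j) (Qᶻ j) ≥0 × sgn j *ᶻ wedge (suc (m + j)) (Pᶻ j) (Qᶻ j) >0
  convergent-order j zero =
    ≥0-≡ (+-≥0 0) (sym (trans (cong (sgn j *ᶻ_) (wedge-self j)) (ℤ.*-zeroʳ (sgn j)))) ,
    >0-≡ (+-suc->0 0) (sym (trans (cong (sgn j *ᶻ_) (wedge-next j)) (unit-square (sgn-unit j))))
  convergent-order j (suc m) with convergent-order j m
  ... | before , after = >0⇒≥0 after , >0-≡ (>0-+ (>0-* (1≤⇒>0 (a-pos (m + j))) after) before) (sym recurrence)
    where
    l = m + j
    distrib : ∀ ε a w₁ w₀ → ε *ᶻ (a *ᶻ w₁ +ᶻ w₀) ≡ a *ᶻ (ε *ᶻ w₁) +ᶻ ε *ᶻ w₀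
    distrib = solve-∀
    recurrence : sgn j *ᶻ wedge (suc (suc l)) (Pᶻ j) (Qᶻ j)
      ≡ aᶻ l *ᶻ (sgn j *ᶻ wedge (suc l) (Pᶻ j) (Qᶻ j)) +ᶻ sgn j *ᶻ wedge l (Pᶻ j) (Qᶻ j)
    recurrence = trans (cong (sgn j *ᶻ_) (wedge-rec l (Pᶻ j) (Qᶻ j))) (distrib (sgn j) (aᶻ l) _ _)

  convergent-order-≤ : ∀ {j N} → j ≤ N → sgn j *ᶻ wedge N (Pᶻ j) (Qᶻ j) ≥0
  convergent-order-≤ {j} j≤N with ℕ.m≤n⇒∃[o]m+o≡n j≤N
  ... | o , refl = subst (λ N → sgn j *ᶻ wedge N (Pᶻ j) (Qᶻ j) ≥0) (ℕ.+-comm o j)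
                         (proj₁ (convergent-order j o))

  convergent-order-< : ∀ {j N} → j < N → sgn j *ᶻ wedge N (Pᶻ j) (Qᶻ j) >0
  convergent-order-< {j} j<N with ℕ.m≤n⇒∃[o]m+o≡n j<N
  ... | o , refl = subst (λ N → sgn j *ᶻ wedge N (Pᶻ j) (Qᶻ j) >0) (cong suc (ℕ.+-comm o j))
                         (proj₂ (convergent-order j o))

  Qᶻ>0 : ∀ {j} → 2 ≤ j → Qᶻ j >0
  Qᶻ>0 {suc zero} (s≤s ())
  Qᶻ>0 {suc (suc k)} _ = 1≤⇒>0 (Q-pos k)

  transfer : ∀ {j N} h v → 2 ≤ j → j ≤ N → sgn j *ᶻ wedge j h (+ v) >0 → sgn j *ᶻ wedge N h (+ v) >0
  transfer {j} {N} h v 2≤j j≤N side = >0-cancelˡ-* (Qᶻ>0 2≤j)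
    (>0-≡ (>0-+ (>0-* (Qᶻ>0 (ℕ.≤-trans 2≤j j≤N)) side) (≥0-* (+-≥0 v) (convergent-order-≤ j≤N)))
          (sym (lem (sgn j) (+ v) h (Pᶻ j) (Qᶻ j) (Pᶻ N) (Qᶻ N))))
    where
    lem : ∀ ε M h pⱼ qⱼ p q → qⱼ *ᶻ (ε *ᶻ (M *ᶻ p -ᶻ h *ᶻ q))
      ≡ q *ᶻ (ε *ᶻ (M *ᶻ pⱼ -ᶻ h *ᶻ qⱼ)) +ᶻ M *ᶻ (ε *ᶻ (qⱼ *ᶻ p -ᶻ pⱼ *ᶻ q))
    lem = solve-∀

  wedge-ℕ : ∀ N u v → wedge N (+ u) (+ v) ≡ + (P a N * v) -ᶻ + (u * Q a N)
  wedge-ℕ N u v =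
    cong₂ _-ᶻ_ (trans (sym (ℤ.pos-* v (P a N))) (cong +_ (ℕ.*-comm v (P a N)))) (sym (ℤ.pos-* u (Q a N)))

  -wedge-ℕ : ∀ N u v → -ᶻ wedge N (+ u) (+ v) ≡ + (u * Q a N) -ᶻ + (P a N * v)
  -wedge-ℕ N u v = trans (cong -ᶻ_ (wedge-ℕ N u v)) (lem (+ (P a N * v)) (+ (u * Q a N)))
    where
    lem : ∀ x y → -ᶻ (x -ᶻ y) ≡ y -ᶻ x
    lem = solve-∀

  below-intro : ∀ {u v j} m → j ≡ 2 + 2 * m → wedge j (+ u) (+ v) >0 → Below a u v
  below-intro {u} {v} m refl w>0 = m , >0⇒< (>0-≡ w>0 (wedge-ℕ _ u v))

  above-intro : ∀ {u v j} m → j ≡ 3 + 2 * m → -ᶻ wedge j (+ u) (+ v) >0 → Above a u v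
  above-intro {u} {v} m refl w<0 = m , >0⇒< (>0-≡ w<0 (-wedge-ℕ _ u v))

  Below⇒eventually : ∀ {u v} → Below a u v → Eventually (λ N → wedge N (+ u) (+ v) >0)
  Below⇒eventually {u} {v} (m , lt) = 2 + 2 * m , λ j≤N →
    >0-≡ (transfer (+ u) v (s≤s (s≤s z≤n)) j≤N
           (>0-≡ (<⇒>0 lt) (trans (sym (wedge-ℕ _ u v)) (sym (sgn-even-* m _)))))
         (sgn-even-* m _)

  Above⇒eventually : ∀ {u v} → Above a u v → Eventually (λ N → -ᶻ wedge N (+ u) (+ v) >0)
  Above⇒eventually {u} {v} (m , lt) = 3 + 2 * m , λ j≤N →
    >0-≡ (transfer (+ u) v (s≤s (s≤s z≤n)) j≤N
           (>0-≡ (<⇒>0 lt) (trans (sym (-wedge-ℕ _ u v)) (sym (sgn-odd-* m _)))))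
         (sgn-odd-* m _)

  wedge-convergent-rec : ∀ N j → wedge N (Pᶻ (suc (suc j))) (Qᶻ (suc (suc j)))
    ≡ aᶻ j *ᶻ wedge N (Pᶻ (suc j)) (Qᶻ (suc j)) +ᶻ wedge N (Pᶻ j) (Qᶻ j)
  wedge-convergent-rec N j = trans (cong₂ (wedge N) (Pᶻ-rec j) (Qᶻ-rec j))
    (lem (aᶻ j) (Pᶻ (suc j)) (Pᶻ j) (Qᶻ (suc j)) (Qᶻ j) (Pᶻ N) (Qᶻ N))
    where
    lem : ∀ a p₁ p₀ q₁ q₀ p q → (a *ᶻ q₁ +ᶻ q₀) *ᶻ p -ᶻ (a *ᶻ p₁ +ᶻ p₀) *ᶻ q
      ≡ a *ᶻ (q₁ *ᶻ p -ᶻ p₁ *ᶻ q) +ᶻ (q₀ *ᶻ p -ᶻ p₀ *ᶻ q)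
    lem = solve-∀

  intermediateᶻ : ∀ u ρ v → + (u + ρ * v) ≡ 1ℤ *ᶻ + u +ᶻ + ρ *ᶻ + v
  intermediateᶻ u ρ v = cong₂ _+ᶻ_ (sym (ℤ.*-identityˡ (+ u))) (ℤ.pos-* ρ v)

  -- At precision N, σ (2cα − 2y) lies in (0, α). With σ = 1 this says E(y) < 0 (the
  -- multiple cα nearest to y lies above it), with σ = −1 that E(y) > 0.
  Window : ℕ → ℤ → ℕ → ℕ → Set
  Window N σ y c = InWindow (Pᶻ N) (σ *ᶻ wedge N (+ (2 * y)) (+ (2 * c)))

  wedge-2* : ∀ N y c → wedge N (+ (2 * y)) (+ (2 * c)) ≡ + 2 *ᶻ wedge N (+ y) (+ c)
  wedge-2* N y c = trans (cong₂ (wedge N) (ℤ.pos-* 2 y) (ℤ.pos-* 2 c)) (lem (+ y) (+ c) (Pᶻ N) (Qᶻ N))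
    where
    lem : ∀ y c p q → (+ 2 *ᶻ c) *ᶻ p -ᶻ (+ 2 *ᶻ y) *ᶻ q ≡ + 2 *ᶻ (c *ᶻ p -ᶻ y *ᶻ q)
    lem = solve-∀

  wedge-suc : ∀ N h M → wedge N h (+ suc M) ≡ wedge N h (+ M) +ᶻ Pᶻ N
  wedge-suc N h M = lem h (+ M) (Pᶻ N) (Qᶻ N)
    where
    lem : ∀ h M p q → (1ℤ +ᶻ M) *ᶻ p -ᶻ h *ᶻ q ≡ (M *ᶻ p -ᶻ h *ᶻ q) +ᶻ p
    lem = solve-∀

  InA⇒window : ∀ {y} → InA a y → ∃ λ c → Eventually (λ N → Window N 1ℤ y c)
  InA⇒window {y} (_ , suc c , _ , below , above) =
    suc c , eventually-map window
      (eventually-× (Below⇒eventually {y} {suc c} below) (Above⇒eventually {2 * y} {2 * suc c ∸ 1} above))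
    where
    window : ∀ N → wedge N (+ y) (+ suc c) >0 × -ᶻ wedge N (+ (2 * y)) (+ (2 * suc c ∸ 1)) >0 →
      Window N 1ℤ y (suc c)
    window N (w>0 , w′<0) =
      >0-≡ (>0-* (+-suc->0 1) w>0) (sym (trans (ℤ.*-identityˡ _) (wedge-2* N y (suc c)))) ,
      >0-≡ w′<0 (trans (lem (Pᶻ N) w′)
                       (cong (λ w → Pᶻ N -ᶻ 1ℤ *ᶻ w) (sym (wedge-suc N (+ (2 * y)) (2 * suc c ∸ 1)))))
      where
      w′ = wedge N (+ (2 * y)) (+ (2 * suc c ∸ 1))
      lem : ∀ p w → -ᶻ w ≡ p -ᶻ 1ℤ *ᶻ (w +ᶻ p)
      lem = solve-∀

  InB⇒window : ∀ {y} → InB a y → ∃ λ c → Eventually (λ N → Window N -1ℤ y c)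
  InB⇒window {y} (_ , c , above , below) =
    c , eventually-map window
      (eventually-× (Above⇒eventually {y} {c} above) (Below⇒eventually {2 * y} {suc (2 * c)} below))
    where
    window : ∀ N → -ᶻ wedge N (+ y) (+ c) >0 × wedge N (+ (2 * y)) (+ suc (2 * c)) >0 → Window N -1ℤ y c
    window N (w<0 , w′>0) =
      >0-≡ (>0-* (+-suc->0 1) w<0) (begin
        + 2 *ᶻ -ᶻ wedge N (+ y) (+ c)             ≡⟨ lem₁ (wedge N (+ y) (+ c)) ⟩
        -1ℤ *ᶻ (+ 2 *ᶻ wedge N (+ y) (+ c))       ≡⟨ cong (λ z → -1ℤ *ᶻ z) (wedge-2* N y c) ⟨
        -1ℤ *ᶻ wedge N (+ (2 * y)) (+ (2 * c))    ∎) ,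
      >0-≡ w′>0 (trans (wedge-suc N (+ (2 * y)) (2 * c)) (lem₂ (Pᶻ N) (wedge N (+ (2 * y)) (+ (2 * c)))))
      where
      open ≡-Reasoning
      lem₁ : ∀ w → + 2 *ᶻ -ᶻ w ≡ -1ℤ *ᶻ (+ 2 *ᶻ w)
      lem₁ = solve-∀
      lem₂ : ∀ p w → w +ᶻ p ≡ p -ᶻ -1ℤ *ᶻ w
      lem₂ = solve-∀

  windows-pair : ∀ {σ y₁ y₂} →
    ∃ (λ c → Eventually (λ N → Window N σ y₁ c)) → ∃ (λ c → Eventually (λ N → Window N σ y₂ c)) →
    ∃₂ λ c₁ c₂ → Eventually (λ N → Window N σ y₁ c₁ × Window N σ y₂ c₂)
  windows-pair {σ} {y₁} {y₂} (c₁ , ev₁) (c₂ , ev₂) =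
    c₁ , c₂ , eventually-× {λ N → Window N σ y₁ c₁} {λ N → Window N σ y₂ c₂} ev₁ ev₂

  same-class⇒windows : ∀ {y₁ y₂} → SameClass a y₁ y₂ →
    ∃ λ σ → Unit σ × ∃₂ λ c₁ c₂ → Eventually (λ N → Window N σ y₁ c₁ × Window N σ y₂ c₂)
  same-class⇒windows {y₁} {y₂} (inj₁ (y₁∈A , y₂∈A)) =
    1ℤ , inj₁ refl , windows-pair {1ℤ} {y₁} {y₂} (InA⇒window {y₁} y₁∈A) (InA⇒window {y₂} y₂∈A)
  same-class⇒windows {y₁} {y₂} (inj₂ (y₁∈B , y₂∈B)) =
    -1ℤ , inj₂ refl , windows-pair { -1ℤ} {y₁} {y₂} (InB⇒window {y₁} y₁∈B) (InB⇒window {y₂} y₂∈B)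

  HalfIntermediate : ℕ → ℕ → ℕ → Set
  HalfIntermediate n k y =
    ∃ λ ρ → 2 * y ≡ p a n + ρ * p a (suc n) × ρ ≤ 2 * k × ρ ≤ a (2 + n) × 2 * k ≤ ρ + a (2 + n)

  -- The convergent vectors (p_i, q_i) and (p_{i+1}, q_{i+1}) form a basis of ℤ², and a
  -- later convergent p_N / q_N stands in for α.
  module AtPrecision (n N : ℕ) (6+n≤N : 6 + n ≤ N) where

    -- P a i = p_n: Defs shifts indices by two.
    i : ℕ
    i = 2 + n

    ε : ℤ
    ε = sgn i

    D : ℕ → ℤ
    D j = wedge N (Pᶻ j) (Qᶻ j)

    A B C : ℤ
    A = sgn i *ᶻ D i
    B = sgn (1 + i) *ᶻ D (1 + i)
    C = sgn (2 + i) *ᶻ D (2 + i)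

    B>0 : B >0
    B>0 = convergent-order-< {1 + i} (ℕ.≤-trans (ℕ.m≤n+m (2 + i) 2) 6+n≤N)

    C>0 : C >0
    C>0 = convergent-order-< {2 + i} (ℕ.≤-trans (ℕ.m≤n+m (3 + i) 1) 6+n≤N)

    A≡aB+C : A ≡ aᶻ i *ᶻ B +ᶻ C
    A≡aB+C = begin
      ε *ᶻ D i                                              ≡⟨ lem ε (aᶻ i) (D i) (D (1 + i)) ⟩
      aᶻ i *ᶻ B +ᶻ sgn (2 + i) *ᶻ (aᶻ i *ᶻ D (1 + i) +ᶻ D i)
        ≡⟨ cong (λ d → aᶻ i *ᶻ B +ᶻ sgn (2 + i) *ᶻ d) (wedge-convergent-rec N i) ⟨
      aᶻ i *ᶻ B +ᶻ C                                        ∎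
      where
      open ≡-Reasoning
      lem : ∀ ε a d₀ d₁ → ε *ᶻ d₀ ≡ a *ᶻ (-ᶻ ε *ᶻ d₁) +ᶻ -ᶻ (-ᶻ ε) *ᶻ (a *ᶻ d₁ +ᶻ d₀)
      lem = solve-∀

    C<B : B -ᶻ C >0
    C<B = >0-≡ (>0-+ (convergent-order-< {3 + i} 6+n≤N) (≥0-* (≤⇒≥0 (a-pos (suc i))) (>0⇒≥0 C>0))) (sym B-C)
      where
      lem : ∀ ε a d₁ d₂ → -ᶻ ε *ᶻ d₁ -ᶻ -ᶻ (-ᶻ ε) *ᶻ d₂
        ≡ -ᶻ (-ᶻ (-ᶻ ε)) *ᶻ (a *ᶻ d₂ +ᶻ d₁) +ᶻ (a -ᶻ 1ℤ) *ᶻ (-ᶻ (-ᶻ ε) *ᶻ d₂)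
      lem = solve-∀
      B-C : B -ᶻ C ≡ sgn (3 + i) *ᶻ D (3 + i) +ᶻ (aᶻ (suc i) -ᶻ 1ℤ) *ᶻ C
      B-C = trans (lem ε (aᶻ (suc i)) (D (1 + i)) (D (2 + i)))
                  (cong (λ d → sgn (3 + i) *ᶻ d +ᶻ (aᶻ (suc i) -ᶻ 1ℤ) *ᶻ C) (sym (wedge-convergent-rec N (suc i))))

    L : ℤ → ℤ → ℤ
    L h M = ε *ᶻ wedge N h M

    L-coordinates : ∀ s r → L (s *ᶻ Pᶻ i +ᶻ r *ᶻ Pᶻ (1 + i)) (s *ᶻ Qᶻ i +ᶻ r *ᶻ Qᶻ (1 + i)) ≡ s *ᶻ A -ᶻ r *ᶻ B
    L-coordinates s r = trans (cong (ε *ᶻ_) (wedge-combination N i s r)) (lem ε s r (D i) (D (1 + i)))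
      where
      lem : ∀ ε s r d₀ d₁ → ε *ᶻ (s *ᶻ d₀ +ᶻ r *ᶻ d₁) ≡ s *ᶻ (ε *ᶻ d₀) -ᶻ r *ᶻ (-ᶻ ε *ᶻ d₁)
      lem = solve-∀

    L-intermediate : ∀ ρ → L (+ (P a i + ρ * P a (1 + i))) (+ (Q a i + ρ * Q a (1 + i))) ≡ A -ᶻ + ρ *ᶻ B
    L-intermediate ρ = begin
      L (+ (P a i + ρ * P a (1 + i))) (+ (Q a i + ρ * Q a (1 + i)))
        ≡⟨ cong₂ L (intermediateᶻ (P a i) ρ (P a (1 + i))) (intermediateᶻ (Q a i) ρ (Q a (1 + i))) ⟩
      L (1ℤ *ᶻ Pᶻ i +ᶻ + ρ *ᶻ Pᶻ (1 + i)) (1ℤ *ᶻ Qᶻ i +ᶻ + ρ *ᶻ Qᶻ (1 + i))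
        ≡⟨ L-coordinates 1ℤ (+ ρ) ⟩
      1ℤ *ᶻ A -ᶻ + ρ *ᶻ B
        ≡⟨ cong (_-ᶻ + ρ *ᶻ B) (ℤ.*-identityˡ A) ⟩
      A -ᶻ + ρ *ᶻ B ∎
      where open ≡-Reasoning

    intermediate-side : ∀ ρ → ρ ≤ a i → L (+ (P a i + ρ * P a (1 + i))) (+ (Q a i + ρ * Q a (1 + i))) >0
    intermediate-side ρ ρ≤a = >0-≡ (>0-+ C>0 (≥0-* (≤⇒≥0 ρ≤a) (>0⇒≥0 B>0)))
      (sym (trans (L-intermediate ρ) (lem A (aᶻ i) (+ ρ) B C A≡aB+C)))
      where
      lem : ∀ A a ρ B C → A ≡ a *ᶻ B +ᶻ C → A -ᶻ ρ *ᶻ B ≡ C +ᶻ (a -ᶻ ρ) *ᶻ B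
      lem A a ρ B C refl = solve (a ∷ ρ ∷ B ∷ C ∷ [])

    L-pair-sum : ∀ {h₁ h₂ M₁ M₂ x t} X → h₁ +ᶻ h₂ ≡ + 2 *ᶻ x → M₁ +ᶻ M₂ ≡ + 2 *ᶻ t →
      L h₁ M₁ +ᶻ L h₂ M₂ ≡ + 2 *ᶻ L x X +ᶻ + 2 *ᶻ ((ε *ᶻ (t -ᶻ X)) *ᶻ Pᶻ N)
    L-pair-sum {h₁} {h₂} {M₁} {M₂} {x} {t} X h-sum M-sum = begin
      L h₁ M₁ +ᶻ L h₂ M₂
        ≡⟨ additive ε h₁ h₂ M₁ M₂ (Pᶻ N) (Qᶻ N) ⟩
      ε *ᶻ ((M₁ +ᶻ M₂) *ᶻ Pᶻ N -ᶻ (h₁ +ᶻ h₂) *ᶻ Qᶻ N)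
        ≡⟨ cong₂ (λ M h → ε *ᶻ (M *ᶻ Pᶻ N -ᶻ h *ᶻ Qᶻ N)) M-sum h-sum ⟩
      ε *ᶻ ((+ 2 *ᶻ t) *ᶻ Pᶻ N -ᶻ (+ 2 *ᶻ x) *ᶻ Qᶻ N)
        ≡⟨ recentre ε t x X (Pᶻ N) (Qᶻ N) ⟩
      + 2 *ᶻ L x X +ᶻ + 2 *ᶻ ((ε *ᶻ (t -ᶻ X)) *ᶻ Pᶻ N) ∎
      where
      open ≡-Reasoning
      additive : ∀ ε h₁ h₂ M₁ M₂ p q → ε *ᶻ (M₁ *ᶻ p -ᶻ h₁ *ᶻ q) +ᶻ ε *ᶻ (M₂ *ᶻ p -ᶻ h₂ *ᶻ q)
        ≡ ε *ᶻ ((M₁ +ᶻ M₂) *ᶻ p -ᶻ (h₁ +ᶻ h₂) *ᶻ q)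
      additive = solve-∀
      recentre : ∀ ε t x X p q → ε *ᶻ ((+ 2 *ᶻ t) *ᶻ p -ᶻ (+ 2 *ᶻ x) *ᶻ q)
        ≡ + 2 *ᶻ (ε *ᶻ (X *ᶻ p -ᶻ x *ᶻ q)) +ᶻ + 2 *ᶻ ((ε *ᶻ (t -ᶻ X)) *ᶻ p)
      recentre = solve-∀

    shift : ∀ {σ} → σ ≡ ε ⊎ σ ≡ -ᶻ ε → ℤ
    shift (inj₁ _) = 0ℤ
    shift (inj₂ _) = ε

    -- When σ = −ε the window is reflected: 2c + ε is then the multiplier on the ε side.
    window-at-level : ∀ {σ y c} (cmp : σ ≡ ε ⊎ σ ≡ -ᶻ ε) → Window N σ y c →
      InWindow (Pᶻ N) (L (+ (2 * y)) (+ (2 * c) +ᶻ shift cmp))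
    window-at-level {y = y} {c} (inj₁ refl) win =
      subst (λ M → InWindow (Pᶻ N) (L (+ (2 * y)) M)) (sym (ℤ.+-identityʳ (+ (2 * c)))) win
    window-at-level {y = y} {c} (inj₂ refl) (ℓ>0 , P-ℓ>0) = >0-≡ P-ℓ>0 (sym L≡) , >0-≡ ℓ>0 (sym P-L≡)
      where
      w = wedge N (+ (2 * y)) (+ (2 * c))
      lem : ∀ ε M h p q → ε *ᶻ ((M +ᶻ ε) *ᶻ p -ᶻ h *ᶻ q) ≡ (ε *ᶻ ε) *ᶻ p -ᶻ -ᶻ ε *ᶻ (M *ᶻ p -ᶻ h *ᶻ q)
      lem = solve-∀
      L≡ : L (+ (2 * y)) (+ (2 * c) +ᶻ ε) ≡ Pᶻ N -ᶻ -ᶻ ε *ᶻ w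
      L≡ = begin
        ε *ᶻ ((+ (2 * c) +ᶻ ε) *ᶻ Pᶻ N -ᶻ + (2 * y) *ᶻ Qᶻ N)
          ≡⟨ lem ε (+ (2 * c)) (+ (2 * y)) (Pᶻ N) (Qᶻ N) ⟩
        (ε *ᶻ ε) *ᶻ Pᶻ N -ᶻ -ᶻ ε *ᶻ w
          ≡⟨ cong (λ e → e *ᶻ Pᶻ N -ᶻ -ᶻ ε *ᶻ w) (unit-square (sgn-unit i)) ⟩
        1ℤ *ᶻ Pᶻ N -ᶻ -ᶻ ε *ᶻ w
          ≡⟨ cong (_-ᶻ -ᶻ ε *ᶻ w) (ℤ.*-identityˡ (Pᶻ N)) ⟩
        Pᶻ N -ᶻ -ᶻ ε *ᶻ w ∎
        where open ≡-Reasoning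
      P-L≡ : Pᶻ N -ᶻ L (+ (2 * y)) (+ (2 * c) +ᶻ ε) ≡ -ᶻ ε *ᶻ w
      P-L≡ = trans (cong (λ z → Pᶻ N -ᶻ z) L≡) (lem′ (Pᶻ N) (-ᶻ ε *ᶻ w))
        where
        lem′ : ∀ p z → p -ᶻ (p -ᶻ z) ≡ z
        lem′ = solve-∀

    ε-unit : ε *ᶻ wedge (1 + i) (Pᶻ i) (Qᶻ i) ≡ 1ℤ
    ε-unit = trans (cong (ε *ᶻ_) (wedge-next i)) (unit-square (sgn-unit i))

    coordinates : ∀ h M → ∃₂ λ s r → h ≡ s *ᶻ Pᶻ i +ᶻ r *ᶻ Pᶻ (1 + i) × M ≡ s *ᶻ Qᶻ i +ᶻ r *ᶻ Qᶻ (1 + i)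
    coordinates h M = ε *ᶻ wedge (1 + i) h M , -ᶻ ε *ᶻ wedge i h M ,
      sym (trans (lemₕ ε h M (Pᶻ i) (Pᶻ (1 + i)) (Qᶻ i) (Qᶻ (1 + i))) (scale h)) ,
      sym (trans (lemₘ ε h M (Pᶻ i) (Pᶻ (1 + i)) (Qᶻ i) (Qᶻ (1 + i))) (scale M))
      where
      lemₕ : ∀ ε h M p₀ p₁ q₀ q₁ → (ε *ᶻ (M *ᶻ p₁ -ᶻ h *ᶻ q₁)) *ᶻ p₀ +ᶻ (-ᶻ ε *ᶻ (M *ᶻ p₀ -ᶻ h *ᶻ q₀)) *ᶻ p₁
        ≡ (ε *ᶻ (q₀ *ᶻ p₁ -ᶻ p₀ *ᶻ q₁)) *ᶻ h
      lemₕ = solve-∀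
      lemₘ : ∀ ε h M p₀ p₁ q₀ q₁ → (ε *ᶻ (M *ᶻ p₁ -ᶻ h *ᶻ q₁)) *ᶻ q₀ +ᶻ (-ᶻ ε *ᶻ (M *ᶻ p₀ -ᶻ h *ᶻ q₀)) *ᶻ q₁
        ≡ (ε *ᶻ (q₀ *ᶻ p₁ -ᶻ p₀ *ᶻ q₁)) *ᶻ M
      lemₘ = solve-∀
      scale : ∀ x → (ε *ᶻ wedge (1 + i) (Pᶻ i) (Qᶻ i)) *ᶻ x ≡ x
      scale x = trans (cong (_*ᶻ x) ε-unit) (ℤ.*-identityˡ x)

    window-pair⇒below-twice : ∀ {k y₁ y₂ M₁ M₂ t} →
      InWindow (Pᶻ N) (L (+ (2 * y₁)) M₁) → InWindow (Pᶻ N) (L (+ (2 * y₂)) M₂) → M₁ +ᶻ M₂ ≡ + 2 *ᶻ t →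
      k + 1 ≤ a i → y₁ + y₂ ≡ P a i + k * P a (1 + i) → + 2 *ᶻ (A -ᶻ + k *ᶻ B) -ᶻ L (+ (2 * y₁)) M₁ >0
    window-pair⇒below-twice {k} {y₁} {y₂} {M₁} {M₂} {t} win₁ win₂ M-sum k<a sum =
      >0-≡ (pair-bound {Pᶻ N} {L h₁ M₁} {L h₂ M₂} {L (+ x) X} {ε *ᶻ (t -ᶻ X)} win₁ win₂
              (>0⇒≥0 (intermediate-side k (ℕ.≤-trans (ℕ.m≤m+n k 1) k<a)))
              (L-pair-sum {h₁} {h₂} {M₁} {M₂} {+ x} {t} X (2*-sum {y₁} {y₂} sum) M-sum))
           (cong (λ ℓ → + 2 *ᶻ ℓ -ᶻ L h₁ M₁) (L-intermediate k))
      where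
      x = P a i + k * P a (1 + i)
      X = + (Q a i + k * Q a (1 + i))
      h₁ = + (2 * y₁)
      h₂ = + (2 * y₂)

    window-pair⇒half-intermediate : ∀ {k y₁ y₂ M₁ M₂ t} →
      InWindow (Pᶻ N) (L (+ (2 * y₁)) M₁) → InWindow (Pᶻ N) (L (+ (2 * y₂)) M₂) → M₁ +ᶻ M₂ ≡ + 2 *ᶻ t →
      k + 1 ≤ a i → y₁ + y₂ ≡ P a i + k * P a (1 + i) → 1 ≤ y₁ → 1 ≤ y₂ → HalfIntermediate n k y₁
    window-pair⇒half-intermediate {k} {y₁} {y₂} {M₁} {M₂} {t} win₁ win₂ M-sum k<a sum 1≤y₁ 1≤y₂ =
      in-coordinates (coordinates h₁ M₁)
      where
      module Para = Parallelogram (a i) (P a i) (P a (1 + i)) (P-increasing n) A B C A≡aB+C (>0⇒≥0 C>0) C<B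
      open ≡-Reasoning
      h₁ = + (2 * y₁)
      h₂ = + (2 * y₂)
      cancel : ∀ h₁ h₂ → h₂ ≡ (h₁ +ᶻ h₂) -ᶻ h₁
      cancel = solve-∀

      in-coordinates : (∃₂ λ s r → h₁ ≡ s *ᶻ Pᶻ i +ᶻ r *ᶻ Pᶻ (1 + i) × M₁ ≡ s *ᶻ Qᶻ i +ᶻ r *ᶻ Qᶻ (1 + i)) →
        HalfIntermediate n k y₁
      in-coordinates (s , r , h≡ , M≡) = conclude (Para.between⇒half-point {s} {r} k
          (>0-≡ (proj₁ win₁) ℓ₁≡ , >0-≡ (2*-pos 1≤y₁) h≡)
          (>0-≡ (window-pair⇒below-twice {k} {y₁} {y₂} {M₁} {M₂} {t} win₁ win₂ M-sum k<a sum)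
                (cong (λ ℓ → + 2 *ᶻ (A -ᶻ + k *ᶻ B) -ᶻ ℓ) ℓ₁≡))
          (>0-≡ (2*-pos 1≤y₂) h₂≡))
        where
        ℓ₁≡ : L h₁ M₁ ≡ s *ᶻ A -ᶻ r *ᶻ B
        ℓ₁≡ = trans (cong₂ L h≡ M≡) (L-coordinates s r)
        h₂≡ : h₂ ≡ + 2 *ᶻ (Pᶻ i +ᶻ + k *ᶻ Pᶻ (1 + i)) -ᶻ (s *ᶻ Pᶻ i +ᶻ r *ᶻ Pᶻ (1 + i))
        h₂≡ = begin
          h₂                                                    ≡⟨ cancel h₁ h₂ ⟩
          (h₁ +ᶻ h₂) -ᶻ h₁                                      ≡⟨ cong₂ _-ᶻ_ (2*-sum {y₁} {y₂} sum) h≡ ⟩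
          + 2 *ᶻ + (P a i + k * P a (1 + i)) -ᶻ (s *ᶻ Pᶻ i +ᶻ r *ᶻ Pᶻ (1 + i))
            ≡⟨ cong (λ u → + 2 *ᶻ (Pᶻ i +ᶻ u) -ᶻ (s *ᶻ Pᶻ i +ᶻ r *ᶻ Pᶻ (1 + i))) (ℤ.pos-* k (P a (1 + i))) ⟩
          + 2 *ᶻ (Pᶻ i +ᶻ + k *ᶻ Pᶻ (1 + i)) -ᶻ (s *ᶻ Pᶻ i +ᶻ r *ᶻ Pᶻ (1 + i)) ∎
        conclude : s ≡ 1ℤ × ∃ (λ ρ → r ≡ + ρ × ρ ≤ 2 * k × ρ ≤ a i × 2 * k ≤ ρ + a i) → HalfIntermediate n k y₁
        conclude (s≡1 , ρ , r≡ρ , bounds) = ρ , ℤ.+-injective (begin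
          + (2 * y₁)                              ≡⟨ h≡ ⟩
          s *ᶻ Pᶻ i +ᶻ r *ᶻ Pᶻ (1 + i)            ≡⟨ cong₂ (λ s r → s *ᶻ Pᶻ i +ᶻ r *ᶻ Pᶻ (1 + i)) s≡1 r≡ρ ⟩
          1ℤ *ᶻ Pᶻ i +ᶻ + ρ *ᶻ Pᶻ (1 + i)         ≡⟨ intermediateᶻ (P a i) ρ (P a (1 + i)) ⟨
          + (P a i + ρ * P a (1 + i))             ∎) , bounds

    windows⇒half-intermediate : ∀ {σ k y₁ y₂ c₁ c₂} → Unit σ → Window N σ y₁ c₁ → Window N σ y₂ c₂ →
      k + 1 ≤ a i → y₁ + y₂ ≡ P a i + k * P a (1 + i) → 1 ≤ y₁ → 1 ≤ y₂ →
      HalfIntermediate n k y₁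
    windows⇒half-intermediate {σ} {k} {y₁} {y₂} {c₁} {c₂} σ-unit win₁ win₂ =
      window-pair⇒half-intermediate {k} {y₁} {y₂} {+ (2 * c₁) +ᶻ δ} {+ (2 * c₂) +ᶻ δ} {+ c₁ +ᶻ + c₂ +ᶻ δ}
        (window-at-level {σ} {y₁} {c₁} cmp win₁) (window-at-level {σ} {y₂} {c₂} cmp win₂) M-sum
      where
      cmp = units-equal-or-opposite σ-unit (sgn-unit i)
      δ = shift cmp
      lem : ∀ c₁ c₂ δ → (+ 2 *ᶻ c₁ +ᶻ δ) +ᶻ (+ 2 *ᶻ c₂ +ᶻ δ) ≡ + 2 *ᶻ (c₁ +ᶻ c₂ +ᶻ δ)
      lem = solve-∀
      M-sum : (+ (2 * c₁) +ᶻ δ) +ᶻ (+ (2 * c₂) +ᶻ δ) ≡ + 2 *ᶻ (+ c₁ +ᶻ + c₂ +ᶻ δ)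
      M-sum = trans (cong₂ (λ u v → (u +ᶻ δ) +ᶻ (v +ᶻ δ)) (ℤ.pos-* 2 c₁) (ℤ.pos-* 2 c₂)) (lem (+ c₁) (+ c₂) δ)

  consecutive-not-both-even : ∀ i → Even (P a i) → Even (P a (suc i)) → ⊥
  consecutive-not-both-even i (divides u p₀≡) (divides v p₁≡) =
    2*≢unit (Qᶻ i *ᶻ + v -ᶻ + u *ᶻ Qᶻ (suc i)) (sgn-unit i) (begin
      + 2 *ᶻ (Qᶻ i *ᶻ + v -ᶻ + u *ᶻ Qᶻ (suc i))           ≡⟨ lem (Qᶻ i) (Qᶻ (suc i)) (+ u) (+ v) ⟩
      Qᶻ i *ᶻ (+ v *ᶻ + 2) -ᶻ (+ u *ᶻ + 2) *ᶻ Qᶻ (suc i)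
        ≡⟨ cong₂ (λ x y → Qᶻ i *ᶻ x -ᶻ y *ᶻ Qᶻ (suc i)) (ℤ.pos-* v 2) (ℤ.pos-* u 2) ⟨
      Qᶻ i *ᶻ + (v * 2) -ᶻ + (u * 2) *ᶻ Qᶻ (suc i)
        ≡⟨ cong₂ (λ x y → Qᶻ i *ᶻ + x -ᶻ + y *ᶻ Qᶻ (suc i)) p₁≡ p₀≡ ⟨
      wedge (suc i) (Pᶻ i) (Qᶻ i)                          ≡⟨ wedge-next i ⟩
      sgn i                                                ∎)
    where
    open ≡-Reasoning
    lem : ∀ q₀ q₁ u v → + 2 *ᶻ (q₀ *ᶻ v -ᶻ u *ᶻ q₁) ≡ q₀ *ᶻ (v *ᶻ + 2) -ᶻ (u *ᶻ + 2) *ᶻ q₁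
    lem = solve-∀

  same-class-pair⇒half-intermediate : ∀ n k {y₁ y₂} → k + 1 ≤ a (2 + n) → y₁ + y₂ ≡ p a n + k * p a (suc n) →
    SameClass a y₁ y₂ →
    HalfIntermediate n k y₁
  same-class-pair⇒half-intermediate n k {y₁} {y₂} k<a sum same-class = from-windows (same-class⇒windows same-class)
    where
    from-windows : (∃ λ σ → Unit σ × ∃₂ λ c₁ c₂ → Eventually (λ N → Window N σ y₁ c₁ × Window N σ y₂ c₂)) →
      HalfIntermediate n k y₁
    from-windows (σ , σ-unit , c₁ , c₂ , windows) with eventually-at (6 + n) windows
    ... | N , 6+n≤N , win₁ , win₂ =
      AtPrecision.windows⇒half-intermediate n N 6+n≤N {σ} {k} {y₁} {y₂} {c₁} {c₂} σ-unit win₁ win₂ k<a sum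
        (proj₁ (same-class⇒positive same-class)) (proj₂ (same-class⇒positive same-class))

  criterion⇒no-same-class-pair : ∀ n k {y₁ y₂} → k + 1 ≤ a (2 + n) →
    Criterion (p a n) (p a (suc n)) (a (2 + n)) k → y₁ ≢ y₂ → y₁ + y₂ ≡ p a n + k * p a (suc n) →
    SameClass a y₁ y₂ → ⊥
  criterion⇒no-same-class-pair n k {y₁} k<a criterion y₁≢y₂ sum same-class =
    even-and-odd (same-class-pair⇒half-intermediate n k k<a sum same-class)
    where
    even-and-odd : HalfIntermediate n k y₁ → ⊥
    even-and-odd (ρ , 2y₁≡ , ρ≤2k , ρ≤a , 2k≤ρ+a) = ℙ.p≢p⁻¹ 0ℙ (begin
      0ℙ                                 ≡⟨ parity-2* y₁ ⟨
      parity (2 * y₁)                    ≡⟨ cong parity 2y₁≡ ⟩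
      parity (p a n + ρ * p a (suc n))   ≡⟨ criterion⇒odd criterion (consecutive-not-both-even (2 + n))
                                              ρ≤2k ρ≤a 2k≤ρ+a (half-point≢ 2y₁≡ sum y₁≢y₂) ⟩
      1ℙ                                 ∎)
      where open ≡-Reasoning

  P>1 : ∀ n → 1 < P a (3 + n)
  P>1 n = ℕ.≤-trans (s≤s (P-pos (suc n))) (P-increasing n)

  half-pos : ∀ n {ρ y} → 2 * y ≡ p a n + ρ * p a (suc n) → 1 ≤ y
  half-pos n {y = zero} 2y≡ with subst (1 ≤_) (sym 2y≡) (ℕ.≤-trans (P-pos (suc n)) (ℕ.m≤m+n _ _))
  ... | ()
  half-pos n {y = suc y} _ = s≤s z≤n

  -- 2y = p_n + ρ p_{n+1} with denominator M = q_n + ρ q_{n+1}: M is odd because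
  -- wedge_{n+1}(2y, M) = ±1, and the fraction lies on the same side of α as p_n / q_n.
  half-intermediate-sides : ∀ n {ρ y} → ρ ≤ a (2 + n) → 2 * y ≡ p a n + ρ * p a (suc n) →
    ∃ λ c → wedge (3 + n) (+ (2 * y)) (+ suc (2 * c)) ≡ sgn (2 + n)
          × sgn (2 + n) *ᶻ wedge (6 + n) (+ (2 * y)) (+ suc (2 * c)) >0
  half-intermediate-sides n {ρ} {y} ρ≤a 2y≡ = odd-denominator (even-or-odd M)
    where
    open ≡-Reasoning
    i = 2 + n
    M = Q a i + ρ * Q a (1 + i)
    next : wedge (1 + i) (+ (2 * y)) (+ M) ≡ sgn i
    next = begin
      wedge (1 + i) (+ (2 * y)) (+ M)
        ≡⟨ cong₂ (wedge (1 + i)) (trans (cong +_ 2y≡) (intermediateᶻ (P a i) ρ (P a (1 + i))))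
                                 (intermediateᶻ (Q a i) ρ (Q a (1 + i))) ⟩
      wedge (1 + i) (1ℤ *ᶻ Pᶻ i +ᶻ + ρ *ᶻ Pᶻ (1 + i)) (1ℤ *ᶻ Qᶻ i +ᶻ + ρ *ᶻ Qᶻ (1 + i))
        ≡⟨ wedge-combination (1 + i) i 1ℤ (+ ρ) ⟩
      1ℤ *ᶻ wedge (1 + i) (Pᶻ i) (Qᶻ i) +ᶻ + ρ *ᶻ wedge (1 + i) (Pᶻ (1 + i)) (Qᶻ (1 + i))
        ≡⟨ cong₂ (λ u w → 1ℤ *ᶻ u +ᶻ + ρ *ᶻ w) (wedge-next i) (wedge-self (1 + i)) ⟩
      1ℤ *ᶻ sgn i +ᶻ + ρ *ᶻ 0ℤ
        ≡⟨ lem (sgn i) (+ ρ) ⟩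
      sgn i ∎
      where
      lem : ∀ e r → 1ℤ *ᶻ e +ᶻ r *ᶻ 0ℤ ≡ e
      lem = solve-∀
    far : sgn i *ᶻ wedge (6 + n) (+ (2 * y)) (+ M) >0
    far = >0-≡ (AtPrecision.intermediate-side n (6 + n) ℕ.≤-refl ρ ρ≤a)
               (cong (λ h → sgn i *ᶻ wedge (6 + n) h (+ M)) (cong +_ (sym 2y≡)))
    odd-denominator : (∃ λ c → M ≡ 2 * c ⊎ M ≡ 1 + 2 * c) → ∃ λ c →
      wedge (3 + n) (+ (2 * y)) (+ suc (2 * c)) ≡ sgn i × sgn i *ᶻ wedge (6 + n) (+ (2 * y)) (+ suc (2 * c)) >0
    odd-denominator (c , inj₁ M≡2c) = ⊥-elim (2*≢unit (wedge (1 + i) (+ y) (+ c)) (sgn-unit i) (begin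
      + 2 *ᶻ wedge (1 + i) (+ y) (+ c)     ≡⟨ wedge-2* (1 + i) y c ⟨
      wedge (1 + i) (+ (2 * y)) (+ (2 * c)) ≡⟨ cong (λ m → wedge (1 + i) (+ (2 * y)) (+ m)) M≡2c ⟨
      wedge (1 + i) (+ (2 * y)) (+ M)       ≡⟨ next ⟩
      sgn i                                 ∎))
    odd-denominator (c , inj₂ M≡2c+1) =
      c , subst (λ m → wedge (1 + i) (+ (2 * y)) (+ m) ≡ sgn i) M≡2c+1 next
        , subst (λ m → sgn i *ᶻ wedge (6 + n) (+ (2 * y)) (+ m) >0) M≡2c+1 far

  half-of-P-1 : ∀ j {w} → + 2 *ᶻ w ≡ Pᶻ (3 + j) -ᶻ 1ℤ → w >0
  half-of-P-1 j eq = >0-cancelˡ-* (+-suc->0 1) (>0-≡ (<⇒>0 (P>1 j)) (sym eq))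

  HalfIntermediatesIn : (ℕ → Set) → ℕ → Set
  HalfIntermediatesIn Class n = ∀ {ρ y} → ρ ≤ a (2 + n) → 2 * y ≡ p a n + ρ * p a (suc n) → Class y

  half-intermediate∈B : ∀ t → HalfIntermediatesIn (InB a) (2 * t)
  half-intermediate∈B t {ρ} {y} ρ≤a 2y≡ with half-intermediate-sides (2 * t) {ρ} {y} ρ≤a 2y≡
  ... | c , next , far = half-pos (2 * t) {ρ} {y} 2y≡ , c ,
    above-intro {y} {c} {3 + 2 * t} t refl (half-of-P-1 (2 * t) twice-gap) ,
    below-intro {2 * y} {suc (2 * c)} {6 + 2 * t} (2 + t) (index t) (>0-≡ far (sgn-even-* t _))
    where
    open ≡-Reasoning
    j = 3 + 2 * t
    index : ∀ t → 6 + 2 * t ≡ 2 + 2 * (2 + t)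
    index = solveℕ-∀
    lem₁ : ∀ w → + 2 *ᶻ -ᶻ w ≡ -ᶻ (+ 2 *ᶻ w)
    lem₁ = solve-∀
    lem₂ : ∀ p w → -ᶻ w ≡ p -ᶻ (w +ᶻ p)
    lem₂ = solve-∀
    twice-gap : + 2 *ᶻ -ᶻ wedge j (+ y) (+ c) ≡ Pᶻ j -ᶻ 1ℤ
    twice-gap = begin
      + 2 *ᶻ -ᶻ wedge j (+ y) (+ c)                      ≡⟨ lem₁ (wedge j (+ y) (+ c)) ⟩
      -ᶻ (+ 2 *ᶻ wedge j (+ y) (+ c))                    ≡⟨ cong -ᶻ_ (wedge-2* j y c) ⟨
      -ᶻ wedge j (+ (2 * y)) (+ (2 * c))                 ≡⟨ lem₂ (Pᶻ j) (wedge j (+ (2 * y)) (+ (2 * c))) ⟩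
      Pᶻ j -ᶻ (wedge j (+ (2 * y)) (+ (2 * c)) +ᶻ Pᶻ j)  ≡⟨ cong (λ w → Pᶻ j -ᶻ w) (wedge-suc j (+ (2 * y)) (2 * c)) ⟨
      Pᶻ j -ᶻ wedge j (+ (2 * y)) (+ suc (2 * c))        ≡⟨ cong (λ w → Pᶻ j -ᶻ w) (trans next (sgn-even t)) ⟩
      Pᶻ j -ᶻ 1ℤ                                         ∎

  half-intermediate∈A : ∀ t → HalfIntermediatesIn (InA a) (1 + 2 * t)
  half-intermediate∈A t {ρ} {y} ρ≤a 2y≡ with half-intermediate-sides (1 + 2 * t) {ρ} {y} ρ≤a 2y≡
  ... | c , next , far = half-pos (1 + 2 * t) {ρ} {y} 2y≡ , suc c , s≤s z≤n ,
    below-intro {y} {suc c} {4 + 2 * t} (1 + t) (index₁ t) (half-of-P-1 (1 + 2 * t) twice-gap) ,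
    above-intro {2 * y} {2 * suc c ∸ 1} {7 + 2 * t} (2 + t) (index₂ t)
      (subst (λ m → -ᶻ wedge (7 + 2 * t) (+ (2 * y)) (+ m) >0) (sym (ℕ.+-suc c (c + 0)))
             (>0-≡ far (sgn-odd-* t _)))
    where
    open ≡-Reasoning
    j = 4 + 2 * t
    index₁ : ∀ t → 4 + 2 * t ≡ 2 + 2 * (1 + t)
    index₁ = solveℕ-∀
    index₂ : ∀ t → 7 + 2 * t ≡ 3 + 2 * (2 + t)
    index₂ = solveℕ-∀
    lem : ∀ p → -1ℤ +ᶻ p ≡ p -ᶻ 1ℤ
    lem = solve-∀
    twice-gap : + 2 *ᶻ wedge j (+ y) (+ suc c) ≡ Pᶻ j -ᶻ 1ℤ
    twice-gap = begin
      + 2 *ᶻ wedge j (+ y) (+ suc c)               ≡⟨ wedge-2* j y (suc c) ⟨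
      wedge j (+ (2 * y)) (+ (2 * suc c))
        ≡⟨ cong (λ m → wedge j (+ (2 * y)) (+ suc m)) (ℕ.+-suc c (c + 0)) ⟩
      wedge j (+ (2 * y)) (+ suc (suc (2 * c)))    ≡⟨ wedge-suc j (+ (2 * y)) (suc (2 * c)) ⟩
      wedge j (+ (2 * y)) (+ suc (2 * c)) +ᶻ Pᶻ j  ≡⟨ cong (λ w → w +ᶻ Pᶻ j) (trans next (sgn-odd t)) ⟩
      -1ℤ +ᶻ Pᶻ j                                  ≡⟨ lem (Pᶻ j) ⟩
      Pᶻ j -ᶻ 1ℤ                                   ∎

  -- The class is that of the side of α on which p_n / q_n lies.
  half-intermediates-same-class : ∀ n → HalfIntermediatesIn (InA a) n ⊎ HalfIntermediatesIn (InB a) n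
  half-intermediates-same-class n with even-or-odd n
  ... | t , inj₁ refl = inj₂ (half-intermediate∈B t)
  ... | t , inj₂ refl = inj₁ (half-intermediate∈A t)

  -- y and y + d p_{n+1} are the halves of p_n + ρ p_{n+1} for ρ = r and ρ = r + 2d.
  same-class-pair : ∀ n d r → 1 ≤ d → d + r + d ≤ a (2 + n) → Even (p a n + r * p a (suc n)) →
    SameClassPair a (p a n + (d + r) * p a (suc n))
  same-class-pair n d r 1≤d k+d≤a (divides y h≡) = y , y + d * p₁ , distinct , sum , classes
    where
    open ≡-Reasoning
    p₀ = p a n
    p₁ = p a (suc n)
    2y≡ : 2 * y ≡ p₀ + r * p₁
    2y≡ = trans (ℕ.*-comm 2 y) (sym h≡)
    double : ∀ y d p₁ → 2 * (y + d * p₁) ≡ 2 * y + 2 * (d * p₁)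
    double = solveℕ-∀
    shift-r : ∀ p₀ r p₁ d → p₀ + r * p₁ + 2 * (d * p₁) ≡ p₀ + (r + 2 * d) * p₁
    shift-r = solveℕ-∀
    2y′≡ : 2 * (y + d * p₁) ≡ p₀ + (r + 2 * d) * p₁
    2y′≡ = begin
      2 * (y + d * p₁)          ≡⟨ double y d p₁ ⟩
      2 * y + 2 * (d * p₁)      ≡⟨ cong (_+ 2 * (d * p₁)) 2y≡ ⟩
      p₀ + r * p₁ + 2 * (d * p₁) ≡⟨ shift-r p₀ r p₁ d ⟩
      p₀ + (r + 2 * d) * p₁     ∎
    r≤a : r ≤ a (2 + n)
    r≤a = ℕ.≤-trans (ℕ.≤-trans (ℕ.m≤n+m r d) (ℕ.m≤m+n (d + r) d)) k+d≤a
    r+2d≤a : r + 2 * d ≤ a (2 + n)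
    r+2d≤a = subst (_≤ a (2 + n)) (reorder d r) k+d≤a
      where
      reorder : ∀ d r → d + r + d ≡ r + 2 * d
      reorder = solveℕ-∀
    distinct : y ≢ y + d * p₁
    distinct y≡ with ℕ.+-cancelˡ-≡ y 0 (d * p₁) (trans (ℕ.+-identityʳ y) y≡)
                   | ℕ.*-mono-≤ 1≤d (P-pos (suc (suc n)))
    ... | 0≡dp₁ | 1≤dp₁ with subst (1 ≤_) (sym 0≡dp₁) 1≤dp₁
    ...   | ()
    sum : y + (y + d * p₁) ≡ p₀ + (d + r) * p₁
    sum = begin
      y + (y + d * p₁)          ≡⟨ lem₁ y (d * p₁) ⟩
      2 * y + d * p₁            ≡⟨ cong (_+ d * p₁) 2y≡ ⟩
      p₀ + r * p₁ + d * p₁      ≡⟨ lem₂ p₀ r p₁ d ⟩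
      p₀ + (d + r) * p₁         ∎
      where
      lem₁ : ∀ y x → y + (y + x) ≡ 2 * y + x
      lem₁ = solveℕ-∀
      lem₂ : ∀ p₀ r p₁ d → p₀ + r * p₁ + d * p₁ ≡ p₀ + (d + r) * p₁
      lem₂ = solveℕ-∀
    classes : SameClass a y (y + d * p₁)
    classes with half-intermediates-same-class n
    ... | inj₁ ∈A = inj₁ (∈A {r} {y} r≤a 2y≡ , ∈A {r + 2 * d} {y + d * p₁} r+2d≤a 2y′≡)
    ... | inj₂ ∈B = inj₂ (∈B {r} {y} r≤a 2y≡ , ∈B {r + 2 * d} {y + d * p₁} r+2d≤a 2y′≡)

  even-sum⇒criterion : ∀ n r → parity (p a (suc n)) ≡ 1ℙ → parity (p a n + suc r * p a (suc n)) ≡ 0ℙ →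
    suc r + 1 ≤ a (2 + n) → ¬ SameClassPair a (p a n + suc r * p a (suc n)) →
    Criterion (p a n) (p a (suc n)) (a (2 + n)) (suc r)
  even-sum⇒criterion n zero p₁-odd x-even _ _ = inj₂ (inj₁ (refl , parity≡1ℙ⇒odd (1ℙ+π≡0ℙ (begin
    1ℙ +ᵖ parity (p a n)                      ≡⟨ cong (λ m → 1ℙ +ᵖ parity m) (ℕ.+-identityʳ (p a n)) ⟨
    1ℙ +ᵖ parity (p a n + 0 * p a (suc n))    ≡⟨ parity-shift (p a n) (p a (suc n)) 1 0 p₁-odd ⟨
    parity (p a n + 1 * p a (suc n))          ≡⟨ x-even ⟩
    0ℙ                                        ∎))))
    where
    open ≡-Reasoning
    1ℙ+π≡0ℙ : ∀ {π} → 1ℙ +ᵖ π ≡ 0ℙ → π ≡ 1ℙ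
    1ℙ+π≡0ℙ {1ℙ} _ = refl
    1ℙ+π≡0ℙ {0ℙ} ()
  even-sum⇒criterion n (suc r) p₁-odd x-even k<a no-pair with suc (suc r) + 1 ℕ.≟ a (2 + n)
  ... | yes k+1≡a = inj₂ (inj₂ (k+1≡a , parity≡1ℙ⇒odd (begin
    parity (a (2 + n) * p a (suc n) + p a n)        ≡⟨ cong parity p₂≡ ⟩
    parity x′                                       ≡⟨ parity-shift (p a n) (p a (suc n)) 1 (suc (suc r)) p₁-odd ⟩
    1ℙ +ᵖ parity (p a n + suc (suc r) * p a (suc n)) ≡⟨ cong (1ℙ +ᵖ_) x-even ⟩
    1ℙ                                              ∎)))
    where
    open ≡-Reasoning
    x′ = p a n + (1 + suc (suc r)) * p a (suc n)
    lem : ∀ k p₀ p₁ → (k + 1) * p₁ + p₀ ≡ p₀ + (1 + k) * p₁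
    lem = solveℕ-∀
    p₂≡ : a (2 + n) * p a (suc n) + p a n ≡ x′
    p₂≡ = subst (λ m → m * p a (suc n) + p a n ≡ x′) k+1≡a (lem (suc (suc r)) (p a n) (p a (suc n)))
  ... | no k+1≢a = ⊥-elim (no-pair (same-class-pair n 2 r (s≤s z≤n)
          (subst (_≤ a (2 + n)) (sym (ℕ.+-suc (2 + r) 1)) (ℕ.≤∧≢⇒< k<a k+1≢a))
          (parity≡0ℙ⇒even _ (trans (sym (parity-shift (p a n) (p a (suc n)) 2 r p₁-odd)) x-even))))

  sum-free⇒criterion : ∀ n k → 1 ≤ k → k + 1 ≤ a (2 + n) → InS a (p a n + k * p a (suc n)) →
    Criterion (p a n) (p a (suc n)) (a (2 + n)) k
  sum-free⇒criterion n (suc r) _ k<a (_ , no-pair) with parity (p a (suc n)) in p₁-parity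
  ... | 0ℙ = inj₁ (parity≡0ℙ⇒even _ p₁-parity)
  ... | 1ℙ with parity (p a n + suc r * p a (suc n)) in x-parity
  ...   | 0ℙ = even-sum⇒criterion n r p₁-parity x-parity k<a no-pair
  ...   | 1ℙ = ⊥-elim (no-pair (same-class-pair n 1 r (s≤s z≤n) k<a
                 (parity≡0ℙ⇒even _
                   (1ℙ+π≡1ℙ (trans (sym (parity-shift (p a n) (p a (suc n)) 1 r p₁-parity)) x-parity)))))
    where
    1ℙ+π≡1ℙ : ∀ {π} → 1ℙ +ᵖ π ≡ 1ℙ → π ≡ 0ℙ
    1ℙ+π≡1ℙ {0ℙ} _ = refl
    1ℙ+π≡1ℙ {1ℙ} ()

  criterion⇒sum-free : ∀ n k → k + 1 ≤ a (2 + n) → Criterion (p a n) (p a (suc n)) (a (2 + n)) k →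
    InS a (p a n + k * p a (suc n))
  criterion⇒sum-free n k k<a criterion =
    ℕ.≤-trans (P-pos (suc n)) (ℕ.m≤m+n _ _) ,
    λ (y₁ , y₂ , y₁≢y₂ , sum , same-class) → criterion⇒no-same-class-pair n k k<a criterion y₁≢y₂ sum same-class

validCF⇒positive : ∀ {a} → ValidCF a → ∀ i → 1 ≤ a i
validCF⇒positive (a₀≥1 , _) zero = a₀≥1
validCF⇒positive (_ , aᵢ≥1) (suc i) = aᵢ≥1 i

mainTheorem5 : (a : ℕ → ℕ) → ValidCF a → (n k : ℕ) → 1 ≤ k → k + 1 ≤ a (n + 2) →
    (InS a (p a n + k * p a (suc n)) ⇔
      (Even (p a (suc n)) ⊎ ((k ≡ 1) × Odd (p a n)) ⊎ ((k + 1 ≡ a (n + 2)) × Odd (p a (n + 2)))))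
mainTheorem5 a valid n k 1≤k k<a =
  subst (λ m → InS a (p a n + k * p a (suc n)) ⇔
                (Even (p a (suc n)) ⊎ ((k ≡ 1) × Odd (p a n)) ⊎ ((k + 1 ≡ a m) × Odd (p a m))))
        (ℕ.+-comm 2 n)
        (mk⇔ (sum-free⇒criterion n k 1≤k k<a′) (criterion⇒sum-free n k k<a′))
  where
  open ContinuedFraction a (validCF⇒positive valid)
  k<a′ : k + 1 ≤ a (2 + n)
  k<a′ = subst (λ m → k + 1 ≤ a m) (ℕ.+-comm n 2) k<a
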